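{- Let $d\ge1$ be an integer. For $n\ge0$ let $a_n(2d+1)=m_1(\mathrm{Im}\mathcal P_2(n,2d+1))$ and $Q_n(2d+1)=|\mathcal Q(n,2d+1)|$. Then: (a) $\displaystyle\sum_{n\ge0}a_n(2d+1)q^n=q^2\prod_{n\ge0}(1+q^{2^n})^2\prod_{i,j\ge0}\left(1+q^{2^i(2d+1)^j}\right)$. (b) For $n\ge0$, $a_{n+2}(2d+1)=Q_n(2d+1)$.
   Context: For an integer $D\ge2$, a $D$-ary partition is a partition (weakly decreasing sequence of positive integers) all of whose parts are powers of $D$ (including $1$). $\mathcal P_2(n,D)$ is the set of $D$-ary partitions of $n$ with at least two parts. For $\lambda=(\lambda_1,\dots,\lambda_\ell)$ with $\ell\ge2$, $\mathrm{pre}_2(\lambda)$ is the partition whose parts are the products $\lambda_i\lambda_j$, $1\le i<j\le\ell$; $\mathrm{Im}\mathcal P_2(n,D)=\{\mathrm{pre}_2(\lambda):\lambda\in\mathcal P_2(n,D)\}$. $m_1(\mu)$ is the number of parts of $\mu$ equal to $1$, and $m_1(S)=\sum_{\mu\in S}m_1(\mu)$ for a set $S$ of partitions. $\mathcal Q(m,2d+1)$ is the set of color partitions of $m$ into distinct parts, where the allowed parts are the integers $2^i(2d+1)^j$ ($i,j\ge0$), a part of size $2^i$ (i.e. $j=0$) comes in three colors and every other part comes in one color; i.e. sets of distinct colored parts whose sizes sum to $m$. -}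

module Defs where

open import Data.Nat using (ℕ; zero; suc; _+_; _*_; _∸_; _^_; _≤_; _<_; _≥_; _≡ᵇ_; _≤?_)
open import Data.Nat.Properties using (_≟_)
open import Data.Fin using (Fin; toℕ)
open import Data.Bool using (if_then_else_)
open import Data.List using (List; []; _∷_; map; _++_; length; upTo; concatMap; filter)
open import Data.Nat.ListAction using (sum)
open import Data.List.Relation.Unary.All using (All)
open import Data.List.Relation.Unary.Linked using (Linked)
open import Data.List.Relation.Unary.Unique.Propositional using (Unique)
open import Data.List.Membership.Propositional using (_∈_)
open import Data.List.Relation.Binary.Permutation.Propositional using (_↭_)
open import Data.Product using (Σ; _×_; _,_)
open import Data.Sum using (_⊎_)
open import Relation.Binary.PropositionalEquality using (_≡_; _≢_)
open import Function.Bundles using (_⇔_)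

-- λ is a D-ary partition of n: weakly decreasing, every part a power of D,
-- parts summing to n (positivity is automatic since D^e ≥ 1).
IsDaryPartition : ℕ → ℕ → List ℕ → Set
IsDaryPartition D n λs =
  Linked _≥_ λs × All (λ x → Σ ℕ (λ e → x ≡ D ^ e)) λs × sum λs ≡ n

InP2 : ℕ → ℕ → List ℕ → Set
InP2 D n λs = IsDaryPartition D n λs × 2 ≤ length λs

pairProducts : List ℕ → List ℕ
pairProducts []       = []
pairProducts (x ∷ xs) = map (x *_) xs ++ pairProducts xs

IsPre2 : List ℕ → List ℕ → Set
IsPre2 λs μ = Linked _≥_ μ × μ ↭ pairProducts λs

InImP2 : ℕ → ℕ → List ℕ → Set
InImP2 D n μ = Σ (List ℕ) (λ λs → InP2 D n λs × IsPre2 λs μ)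

m1 : List ℕ → ℕ
m1 []       = 0
m1 (x ∷ xs) = (if x ≡ᵇ 1 then 1 else 0) + m1 xs

-- "m_1(Im P_2(n,D)) = k": there is a duplicate-free list enumerating
-- exactly the set Im P_2(n,D), and the sum of m_1 over it is k.
M1ImP2Is : ℕ → ℕ → ℕ → Set
M1ImP2Is D n k = Σ (List (List ℕ)) (λ L →
  Unique L × (∀ μ → (μ ∈ L) ⇔ InImP2 D n μ) × sum (map m1 L) ≡ k)

-- A colored part is (size , color) with color : Fin 3; allowed sizes are
-- 2^i (2d+1)^j; colors other than 0 are only allowed for sizes that are
-- powers of 2 (those come in three colors, all others in one color).

ColoredPart : Set
ColoredPart = ℕ × Fin 3

AllowedPart : ℕ → ColoredPart → Set
AllowedPart d (s , c) =
  Σ ℕ (λ i → Σ ℕ (λ j → s ≡ 2 ^ i * (2 * d + 1) ^ j))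
  × (toℕ c ≢ 0 → Σ ℕ (λ i → s ≡ 2 ^ i))

-- strict (lexicographic) order on colored parts; a set of distinct colored
-- parts is represented canonically as a strictly decreasing list
_≺_ : ColoredPart → ColoredPart → Set
(s , c) ≺ (s' , c') = s < s' ⊎ (s ≡ s' × toℕ c < toℕ c')

partSize : ColoredPart → ℕ
partSize (s , _) = s

IsQ : ℕ → ℕ → List ColoredPart → Set
IsQ d m π =
  Linked (λ x y → y ≺ x) π × All (AllowedPart d) π × sum (map partSize π) ≡ m

QCountIs : ℕ → ℕ → ℕ → Set
QCountIs d m k = Σ (List (List ColoredPart)) (λ L →
  Unique L × (∀ π → (π ∈ L) ⇔ IsQ d m π) × length L ≡ k)

Series : Set
Series = ℕ → ℕ

_⊛_ : Series → Series → Series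
(f ⊛ g) n = sum (map (λ k → f k * g (n ∸ k)) (upTo (suc n)))

onePlusQ : ℕ → Series
onePlusQ e n = (if n ≡ᵇ 0 then 1 else 0) + (if n ≡ᵇ e then 1 else 0)

oneS : Series
oneS n = if n ≡ᵇ 0 then 1 else 0

prodS : List ℕ → Series
prodS []       = oneS
prodS (e ∷ es) = onePlusQ e ⊛ prodS es

-- the exponents e ≤ N of the factors (1+q^e) of
--   ∏_{n≥0} (1+q^{2^n})^2 ∏_{i,j≥0} (1+q^{2^i (2d+1)^j}),
-- with multiplicity (only these factors affect the coefficient of q^N;
-- indices i, j ≤ N suffice since 2^i > N and (2d+1)^j > N otherwise).
exponentsUpTo : ℕ → ℕ → List ℕ
exponentsUpTo d N =
  filter (_≤? N)
    (concatMap (λ i → 2 ^ i ∷ 2 ^ i ∷ []) (upTo (suc N))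
     ++ concatMap (λ i → map (λ j → 2 ^ i * (2 * d + 1) ^ j) (upTo (suc N)))
                  (upTo (suc N)))

infProdCoef : ℕ → ℕ → ℕ
infProdCoef d N = prodS (exponentsUpTo d N) N

rhsCoef : ℕ → ℕ → ℕ
rhsCoef d zero          = 0
rhsCoef d (suc zero)    = 0
rhsCoef d (suc (suc m)) = infProdCoef d m

{-# OPTIONS --safe #-}

-- Write D = 2d + 1 and let λ be a D-ary partition with k parts equal to 1. A product of two parts
-- is 1 only for two 1-parts, so m₁(pre₂ λ) = C(k, 2). When k ≥ 2, λ is determined by pre₂ λ: the
-- multiplicity in λ of each t ≥ 2 follows by induction on t, since a pair of parts with product t
-- either has both parts < t or is {t, 1}. Hence a_n = Σ C(m₁ λ, 2) over the D-ary partitions λ of n,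
-- with generating function q²/(1 − q)³ · ∏_{j≥1} 1/(1 − q^{D^j}); writing every 1/(1 − x) as
-- ∏_i (1 + x^{2^i}) gives (a). As D is odd, the numbers 2^i D^j are pairwise distinct, so expanding
-- the product counts the sets of distinct colored parts of (b).

module Submission where

open import Defs

open import Data.Bool using (true; false; if_then_else_)
open import Data.Fin using (Fin; toℕ)
import Data.Fin.Properties as Fin
open import Data.List
  using (List; []; _∷_; [_]; map; _++_; upTo; applyUpTo; filter; concatMap; replicate; length;
         deduplicate; cartesianProductWith)
import Data.List.Properties as List
open import Data.List.Membership.Propositional using (_∈_; find; lose)
open import Data.List.Membership.Propositional.Properties
  using (∈-concatMap⁺; ∈-concatMap⁻; ∈-map⁺; ∈-map⁻; ∈-upTo⁺; ∈-++⁺ˡ; ∈-++⁺ʳ; ∈-++⁻; ∈-∃++;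
         ∈-filter⁺; ∈-filter⁻; ∈-deduplicate⁺; ∈-deduplicate⁻;
         ∈-cartesianProductWith⁺; ∈-cartesianProductWith⁻)
open import Data.List.Relation.Binary.Permutation.Propositional
  using (_↭_; refl; prep; swap; trans; ↭-refl; ↭-sym; ↭-trans; ↭-reflexive; ↭⇒↭ₛ;
         module PermutationReasoning)
import Data.List.Relation.Binary.Permutation.Propositional.Properties as Perm
import Data.List.Relation.Binary.Permutation.Setoid.Properties as PermSetoid
open import Data.List.Relation.Binary.Pointwise using (Pointwise-≡⇒≡)
open import Data.List.Relation.Binary.Sublist.Propositional using (_⊆_; []; _∷_; _∷ʳ_; minimum)
open import Data.List.Relation.Binary.Sublist.Propositional.Properties using (Any-resp-⊆; All-resp-⊆)
open import Data.List.Relation.Unary.All as All using (All; []; _∷_)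
import Data.List.Relation.Unary.All.Properties as All
open import Data.List.Relation.Unary.AllPairs as AllPairs using (AllPairs; []; _∷_)
import Data.List.Relation.Unary.AllPairs.Properties as AllPairs
open import Data.List.Relation.Unary.Any using (here; there)
open import Data.List.Relation.Unary.Linked as Linked using (Linked; []; [-]; _∷_)
import Data.List.Relation.Unary.Linked.Properties as Linked
open import Data.List.Relation.Unary.Sorted.TotalOrder.Properties using (↗↭↗⇒≋)
open import Data.List.Relation.Unary.Unique.Propositional using (Unique)
import Data.List.Relation.Unary.Unique.Propositional.Properties as Unique
import Data.List.Sort as Sort
open import Data.Nat
  using (ℕ; zero; suc; _+_; _*_; _∸_; _^_; _≤_; _<_; _≥_; _≡ᵇ_; _≤?_; _<?_; z≤n; s≤s;
         NonZero; >-nonZero)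
open import Data.Nat.Combinatorics using (_C_; nCk+nC[k+1]≡[n+1]C[k+1]; nC1≡n)
open import Data.Nat.Divisibility using (_∣_; ∣-trans; ∣1⇒≡1; ∣m+n∣m⇒∣n; m∣m*n)
open import Data.Nat.Induction using (<-rec)
open import Data.Nat.ListAction using (sum)
open import Data.Nat.ListAction.Properties using (sum-++; sum-↭)
open import Data.Nat.Primality using (euclidsLemma; prime[2])
open import Data.Nat.Properties
open import Data.Nat.Tactic.RingSolver using (solve-∀)
open import Data.Product using (Σ; _×_; _,_; proj₁; proj₂; ∃-syntax)
open import Data.Product.Properties using () renaming (≡-dec to ×-≡-dec)
open import Data.Sum using (inj₁; inj₂; [_,_]′)
open import Function using (_∘_; case_of_)
open import Function.Bundles using (_⇔_; mk⇔)
import Relation.Binary.Construct.On as On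
open import Relation.Binary.Definitions using (DecidableEquality; tri<; tri≈; tri>)
open import Relation.Binary.Properties.DecTotalOrder ≤-decTotalOrder using (≥-decTotalOrder)
import Relation.Binary.Properties.TotalOrder as TotalOrder
open import Relation.Binary.PropositionalEquality
  using (_≡_; _≢_; _≗_; refl; sym; cong; cong₂; subst; setoid; module ≡-Reasoning)
  renaming (trans to ≡-trans)
open import Relation.Nullary using (yes; no; ¬_; ¬?; _×-dec_; does; contradiction)
open import Relation.Unary using (Decidable)

open import Algebra.Properties.CommutativeSemigroup +-commutativeSemigroup using (interchange)
open import Data.List.Relation.Unary.Unique.DecPropositional.Properties (List.≡-dec _≟_)
  using (deduplicate-!)
open Sort ≥-decTotalOrder using () renaming (sort to sort≥; sort-↭ to sort≥-↭; sort-↗ to sort≥-↗)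

-- Finite sums

∑< : ℕ → (ℕ → ℕ) → ℕ
∑< zero    g = 0
∑< (suc n) g = g 0 + ∑< n (λ k → g (suc k))

syntax ∑< n (λ k → e) = ∑[ k < n ] e

∑-cong : ∀ {g h} n → (∀ k → k < n → g k ≡ h k) → ∑< n g ≡ ∑< n h
∑-cong zero    eq = refl
∑-cong (suc n) eq = cong₂ _+_ (eq 0 (s≤s z≤n)) (∑-cong n (λ k k<n → eq (suc k) (s≤s k<n)))

∑-zero : ∀ {g} n → (∀ k → g k ≡ 0) → ∑< n g ≡ 0
∑-zero zero    eq = refl
∑-zero (suc n) eq = cong₂ _+_ (eq 0) (∑-zero n (λ k → eq (suc k)))

∑-distrib-+ : ∀ g h n → ∑[ k < n ] (g k + h k) ≡ ∑< n g + ∑< n h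
∑-distrib-+ g h zero    = refl
∑-distrib-+ g h (suc n) =
  ≡-trans (cong (g 0 + h 0 +_) (∑-distrib-+ (λ k → g (suc k)) (λ k → h (suc k)) n))
          (interchange (g 0) (h 0) _ _)

∑-split : ∀ g m n → ∑< (m + n) g ≡ ∑< m g + ∑[ k < n ] g (m + k)
∑-split g zero    n = refl
∑-split g (suc m) n = ≡-trans (cong (g 0 +_) (∑-split (λ k → g (suc k)) m n)) (sym (+-assoc (g 0) _ _))

∑-truncate : ∀ g {m n} → (∀ k → m ≤ k → g k ≡ 0) → m ≤ n → ∑< n g ≡ ∑< m g
∑-truncate g {m} vanish m≤n with m≤n⇒∃[o]m+o≡n m≤n
... | o , refl = begin
  ∑< (m + o) g                   ≡⟨ ∑-split g m o ⟩
  ∑< m g + ∑[ k < o ] g (m + k)   ≡⟨ cong (∑< m g +_) (∑-zero o (λ k → vanish (m + k) (m≤m+n m k))) ⟩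
  ∑< m g + 0                      ≡⟨ +-identityʳ _ ⟩
  ∑< m g                          ∎
  where open ≡-Reasoning

∑-evens-odds : ∀ g n → ∑< (2 * n) g ≡ ∑[ k < n ] g (2 * k) + ∑[ k < n ] g (suc (2 * k))
∑-evens-odds g zero    = refl
∑-evens-odds g (suc n) = begin
  ∑< (2 * suc n) g
    ≡⟨ cong (λ m → ∑< m g) (*-suc 2 n) ⟩
  g 0 + (g 1 + ∑< (2 * n) g₂)
    ≡⟨ cong (λ s → g 0 + (g 1 + s)) (∑-evens-odds g₂ n) ⟩
  g 0 + (g 1 + (∑[ k < n ] g₂ (2 * k) + ∑[ k < n ] g₂ (suc (2 * k))))
    ≡⟨ ≡-trans (sym (+-assoc (g 0) _ _)) (interchange (g 0) (g 1) _ _) ⟩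
  (g 0 + ∑[ k < n ] g₂ (2 * k)) + (g 1 + ∑[ k < n ] g₂ (suc (2 * k)))
    ≡⟨ cong₂ (λ e o → (g 0 + e) + (g 1 + o))
             (∑-cong n (λ k _ → cong g (sym (*-suc 2 k))))
             (∑-cong n (λ k _ → cong (λ m → g (suc m)) (sym (*-suc 2 k)))) ⟩
  ∑[ k < suc n ] g (2 * k) + ∑[ k < suc n ] g (suc (2 * k)) ∎
  where
  open ≡-Reasoning
  g₂ : ℕ → ℕ
  g₂ k = g (suc (suc k))

sum-map-applyUpTo : ∀ (g f : ℕ → ℕ) n → sum (map g (applyUpTo f n)) ≡ ∑[ k < n ] g (f k)
sum-map-applyUpTo g f zero    = refl
sum-map-applyUpTo g f (suc n) = cong (g (f 0) +_) (sum-map-applyUpTo g (λ k → f (suc k)) n)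

sum-map-upTo : ∀ (g : ℕ → ℕ) n → sum (map g (upTo n)) ≡ ∑< n g
sum-map-upTo g = sum-map-applyUpTo g (λ k → k)

-- Lists

module _ {A : Set} where

  concatMap-∷ : ∀ (f : ℕ → A) (h : ℕ → List A) is →
    concatMap (λ i → f i ∷ h i) is ↭ map f is ++ concatMap h is
  concatMap-∷ f h []       = ↭-refl
  concatMap-∷ f h (i ∷ is) = prep (f i)
    (↭-trans (Perm.++⁺ˡ (h i) (concatMap-∷ f h is)) (Perm.shifts (h i) (map f is)))

  concatMap-transpose : ∀ (F : ℕ → ℕ → A) is js →
    concatMap (λ i → map (F i) js) is ↭ concatMap (λ j → map (λ i → F i j) is) js
  concatMap-transpose F []       js = ↭-reflexive (sym (no-rows js))
    where
    no-rows : ∀ js → concatMap (λ (_ : ℕ) → [] {A = A}) js ≡ []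
    no-rows []       = refl
    no-rows (_ ∷ js) = no-rows js
  concatMap-transpose F (i ∷ is) js = ↭-trans
    (Perm.++⁺ˡ (map (F i) js) (concatMap-transpose F is js))
    (↭-sym (concatMap-∷ (F i) (λ j → map (λ i → F i j) is) js))

  concatMap-upTo-suc : ∀ (g : ℕ → List A) n → concatMap g (upTo (suc n)) ↭ g n ++ concatMap g (upTo n)
  concatMap-upTo-suc g n = begin
    concatMap g (upTo (suc n))        ≡⟨ cong (concatMap g) (List.upTo-∷ʳ n) ⟨
    concatMap g (upTo n ++ [ n ])     ≡⟨ List.concatMap-++ g (upTo n) [ n ] ⟩
    concatMap g (upTo n) ++ g n ++ [] ≡⟨ cong (concatMap g (upTo n) ++_) (List.++-identityʳ (g n)) ⟩
    concatMap g (upTo n) ++ g n       ↭⟨ Perm.++-comm (concatMap g (upTo n)) (g n) ⟩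
    g n ++ concatMap g (upTo n)       ∎
    where open PermutationReasoning

module _ {A B : Set} where

  Unique-concatMap : ∀ (G : A → List B) {cs} → Unique cs → (∀ c → Unique (G c)) →
    (∀ {c c′ x} → x ∈ G c → x ∈ G c′ → c ≡ c′) → Unique (concatMap G cs)
  Unique-concatMap G cs! G! det = Unique.concat⁺ (All.map⁺ (All.universal G! _))
    (AllPairs.map⁺ {f = G} (AllPairs.map (λ c≢c′ {_} (x∈ , x∈′) → c≢c′ (det x∈ x∈′)) cs!))

  sum-map-concatMap : ∀ (f : B → ℕ) (G : A → List B) cs →
    sum (map f (concatMap G cs)) ≡ sum (map (λ c → sum (map f (G c))) cs)
  sum-map-concatMap f G []       = refl
  sum-map-concatMap f G (c ∷ cs) = begin
    sum (map f (G c ++ concatMap G cs))              ≡⟨ cong sum (List.map-++ f (G c) _) ⟩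
    sum (map f (G c) ++ map f (concatMap G cs))      ≡⟨ sum-++ (map f (G c)) _ ⟩
    sum (map f (G c)) + sum (map f (concatMap G cs)) ≡⟨ cong (sum (map f (G c)) +_) (sum-map-concatMap f G cs) ⟩
    sum (map f (G c)) + sum (map (λ c → sum (map f (G c))) cs) ∎
    where open ≡-Reasoning

map-cartesianProductWith : ∀ {A B C E : Set} (h : C → E) (f : A → B → C) xs ys →
  map h (cartesianProductWith f xs ys) ≡ concatMap (λ x → map (λ y → h (f x y)) ys) xs
map-cartesianProductWith h f []       ys = refl
map-cartesianProductWith h f (x ∷ xs) ys = begin
  map h (map (f x) ys ++ cartesianProductWith f xs ys)       ≡⟨ List.map-++ h (map (f x) ys) _ ⟩
  map h (map (f x) ys) ++ map h (cartesianProductWith f xs ys)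
    ≡⟨ cong₂ _++_ (sym (List.map-∘ ys)) (map-cartesianProductWith h f xs ys) ⟩
  map (λ y → h (f x y)) ys ++ concatMap (λ x → map (λ y → h (f x y)) ys) xs ∎
  where open ≡-Reasoning

∈⇒≤sum : ∀ {x xs} → x ∈ xs → x ≤ sum xs
∈⇒≤sum {xs = x ∷ xs} (here refl) = m≤m+n x (sum xs)
∈⇒≤sum {xs = y ∷ xs} (there x∈)  = ≤-trans (∈⇒≤sum x∈) (m≤n+m (sum xs) y)

sum-map-filter : ∀ {A : Set} {P : A → Set} (P? : Decidable P) (f : A → ℕ) xs →
  (∀ x → ¬ P x → f x ≡ 0) → sum (map f (filter P? xs)) ≡ sum (map f xs)
sum-map-filter P? f []       _     = refl
sum-map-filter P? f (x ∷ xs) f≡0 with P? x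
... | yes _  = cong (f x +_) (sum-map-filter P? f xs f≡0)
... | no  ¬p = ≡-trans (sum-map-filter P? f xs f≡0) (cong (_+ sum (map f xs)) (sym (f≡0 x ¬p)))

sum-map-vanishing : ∀ {A : Set} (f : A → ℕ) xs → (∀ {x} → x ∈ xs → f x ≡ 0) → sum (map f xs) ≡ 0
sum-map-vanishing f []       _   = refl
sum-map-vanishing f (x ∷ xs) f≡0 = cong₂ _+_ (f≡0 (here refl)) (sum-map-vanishing f xs (f≡0 ∘ there))

Unique-map-injectiveOn : ∀ {A B : Set} (f : A → B) {xs} →
  (∀ {x y} → x ∈ xs → y ∈ xs → f x ≡ f y → x ≡ y) → Unique xs → Unique (map f xs)
Unique-map-injectiveOn f {[]}     _   []           = []
Unique-map-injectiveOn f {x ∷ xs} inj (x∉xs ∷ xs!) =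
  All.map⁺ (All.tabulate (λ y∈ fx≡fy → All.lookup x∉xs y∈ (inj (here refl) (there y∈) fx≡fy)))
  ∷ Unique-map-injectiveOn f (λ x∈ y∈ → inj (there x∈) (there y∈)) xs!

length-filter-∷ : ∀ {A : Set} {P : A → Set} (P? : Decidable P) x xs →
  length (filter P? (x ∷ xs)) ≡ (if does (P? x) then 1 else 0) + length (filter P? xs)
length-filter-∷ P? x xs with does (P? x)
... | true  = refl
... | false = refl

module _ {A : Set} {R : A → A → Set} where

  AllPairs-resp-⊆ : ∀ {xs ys} → xs ⊆ ys → AllPairs R ys → AllPairs R xs
  AllPairs-resp-⊆ []         []            = []
  AllPairs-resp-⊆ (y ∷ʳ p)   (_ ∷ ys!)     = AllPairs-resp-⊆ p ys!
  AllPairs-resp-⊆ (refl ∷ p) (y-ys ∷ ys!)  = All-resp-⊆ p y-ys ∷ AllPairs-resp-⊆ p ys!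

  ⊆-strictlySorted : (∀ {x} → ¬ R x x) → (∀ {x y z} → R x y → R y z → R x z) → DecidableEquality A →
    ∀ {xs ys} → AllPairs R xs → AllPairs R ys → (∀ {x} → x ∈ xs → x ∈ ys) → xs ⊆ ys
  ⊆-strictlySorted irr tr _≟_ {[]}     {ys}     _   _   _   = minimum ys
  ⊆-strictlySorted irr tr _≟_ {x ∷ xs} {[]}     _   _   sub with () ← sub (here refl)
  ⊆-strictlySorted irr tr _≟_ {x ∷ xs} {y ∷ ys} (x-xs ∷ xs!) (y-ys ∷ ys!) sub with x ≟ y
  ... | yes refl = refl ∷ ⊆-strictlySorted irr tr _≟_ xs! ys! sub′
    where
    sub′ : ∀ {z} → z ∈ xs → z ∈ ys
    sub′ z∈ with sub (there z∈)
    ... | here refl = contradiction (All.lookup x-xs z∈) irr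
    ... | there z∈ys = z∈ys
  ... | no x≢y = y ∷ʳ ⊆-strictlySorted irr tr _≟_ (x-xs ∷ xs!) ys! sub′
    where
    x∈ys : x ∈ ys
    x∈ys with sub (here refl)
    ... | here x≡y = contradiction x≡y x≢y
    ... | there x∈ys = x∈ys
    sub′ : ∀ {z} → z ∈ x ∷ xs → z ∈ ys
    sub′ (here refl) = x∈ys
    sub′ (there z∈) with sub (there z∈)
    ... | here refl = contradiction (tr (All.lookup y-ys x∈ys) (All.lookup x-xs z∈)) irr
    ... | there z∈ys = z∈ys

sum-replicate : ∀ c p → sum (replicate c p) ≡ c * p
sum-replicate zero    p = refl
sum-replicate (suc c) p = cong (p +_) (sum-replicate c p)

Linked-replicate-++ : ∀ c {p ys} → All (_≤ p) ys → Linked _≥_ ys → Linked _≥_ (replicate c p ++ ys)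
Linked-replicate-++ zero          ys≤p      ys↘ = ys↘
Linked-replicate-++ (suc zero)    []        ys↘ = [-]
Linked-replicate-++ (suc zero)    (y≤p ∷ _) ys↘ = y≤p ∷ ys↘
Linked-replicate-++ (suc (suc c)) ys≤p      ys↘ = ≤-refl ∷ Linked-replicate-++ (suc c) ys≤p ys↘

Linked-≥-bounded : ∀ {x xs} → Linked _≥_ (x ∷ xs) → All (_≤ x) xs
Linked-≥-bounded xs↘ with Linked.Linked⇒AllPairs (λ x≥y y≥z → ≤-trans y≥z x≥y) xs↘
... | xs≤x ∷ _ = xs≤x

span-replicate : ∀ p {xs} → Linked _≥_ xs → All (_≤ p) xs →
  ∃[ c ] ∃[ ys ] xs ≡ replicate c p ++ ys × All (_< p) ys
span-replicate p {[]}     _   _            = 0 , [] , refl , []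
span-replicate p {x ∷ xs} xs↘ (x≤p ∷ xs≤p) with x ≟ p
... | yes refl with span-replicate p (Linked.tail xs↘) xs≤p
...   | c , ys , refl , ys<p = suc c , ys , refl , ys<p
span-replicate p {x ∷ xs} xs↘ (x≤p ∷ xs≤p) | no x≢p =
  0 , x ∷ xs , refl , x<p ∷ All.map (λ y≤x → ≤-<-trans y≤x x<p) (Linked-≥-bounded xs↘)
  where
  x<p : x < p
  x<p = ≤∧≢⇒< x≤p x≢p

Linked-≥-↭⇒≡ : ∀ {xs ys} → Linked _≥_ xs → Linked _≥_ ys → xs ↭ ys → xs ≡ ys
Linked-≥-↭⇒≡ xs↘ ys↘ p =
  Pointwise-≡⇒≡ (↗↭↗⇒≋ (TotalOrder.≥-totalOrder ≤-totalOrder) xs↘ ys↘ (↭⇒↭ₛ p))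

-- Arithmetic

n<2^n : ∀ n → n < 2 ^ n
n<2^n zero    = s≤s z≤n
n<2^n (suc n) = <-≤-trans (s≤s (n<2^n n)) (≤-trans (+-monoˡ-≤ (2 ^ n) (m^n>0 2 n))
                                                   (≤-reflexive (cong (2 ^ n +_) (sym (+-identityʳ (2 ^ n))))))

IsPowerOf : ℕ → ℕ → Set
IsPowerOf D x = Σ ℕ (λ e → x ≡ D ^ e)

^-cancelʳ-< : ∀ D .{{_ : NonZero D}} {a b} → D ^ a < D ^ b → a < b
^-cancelʳ-< D {a} {b} lt with b ≤? a
... | yes b≤a = contradiction (^-monoʳ-≤ D b≤a) (<⇒≱ lt)
... | no  b≰a = ≰⇒> b≰a

^-injectiveʳ : ∀ D → 1 < D → ∀ {a b} → D ^ a ≡ D ^ b → a ≡ b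
^-injectiveʳ D 1<D {a} {b} eq with <-cmp a b
... | tri< a<b _ _ = contradiction eq (<⇒≢ (^-monoʳ-< D 1<D a<b))
... | tri≈ _ a≡b _ = a≡b
... | tri> _ _ a>b = contradiction (sym eq) (<⇒≢ (^-monoʳ-< D 1<D a>b))

3+k≤^suc : ∀ {D} k → 3 ≤ D → 3 + k ≤ D ^ suc k
3+k≤^suc {D} zero    3≤D = ≤-trans 3≤D (≤-reflexive (sym (*-identityʳ D)))
3+k≤^suc {D} (suc k) 3≤D = begin
  suc (3 + k)    ≤⟨ s≤s (3+k≤^suc k 3≤D) ⟩
  suc X          ≤⟨ +-monoˡ-≤ X (≤-trans (s≤s z≤n) (3+k≤^suc k 3≤D)) ⟩
  X + X          ≡⟨ cong (X +_) (+-identityʳ X) ⟨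
  2 * X          ≤⟨ *-monoˡ-≤ X (≤-trans (s≤s (s≤s z≤n)) 3≤D) ⟩
  D * X          ∎
  where
  open ≤-Reasoning
  X : ℕ
  X = D ^ suc k

power≤n⇒≤^[n∸2] : ∀ {D k n} → 3 ≤ D → D ^ k ≤ n → D ^ k ≤ D ^ (n ∸ 2)
power≤n⇒≤^[n∸2] {D} {zero}  {n} 3≤D _   = m^n>0 D {{>-nonZero (≤-trans (s≤s z≤n) 3≤D)}} (n ∸ 2)
power≤n⇒≤^[n∸2] {D} {suc k} {n} 3≤D D^k≤n = ^-monoʳ-≤ D {{>-nonZero (≤-trans (s≤s z≤n) 3≤D)}} (begin
  suc k          ≡⟨ m+n∸n≡m (suc k) 2 ⟨
  suc k + 2 ∸ 2  ≤⟨ ∸-monoˡ-≤ 2 (≤-trans (≤-reflexive (+-comm (suc k) 2)) (3+k≤^suc k 3≤D)) ⟩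
  D ^ suc k ∸ 2  ≤⟨ ∸-monoˡ-≤ 2 D^k≤n ⟩
  n ∸ 2          ∎)
  where open ≤-Reasoning

3≤2d+1 : ∀ {d} → 1 ≤ d → 3 ≤ 2 * d + 1
3≤2d+1 1≤d = +-monoˡ-≤ 1 (*-monoʳ-≤ 2 1≤d)

2∤2d+1 : ∀ d → ¬ 2 ∣ 2 * d + 1
2∤2d+1 d 2∣ = contradiction (∣1⇒≡1 (∣m+n∣m⇒∣n 2∣ (m∣m*n d))) λ ()

2∤[2d+1]^ : ∀ d j → ¬ 2 ∣ (2 * d + 1) ^ j
2∤[2d+1]^ d zero    2∣1 = contradiction (∣1⇒≡1 2∣1) λ ()
2∤[2d+1]^ d (suc j) 2∣  = [ 2∤2d+1 d , 2∤[2d+1]^ d j ]′ (euclidsLemma (2 * d + 1) _ prime[2] 2∣)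

2∣2^suc* : ∀ i a → 2 ∣ 2 ^ suc i * a
2∣2^suc* i a = ∣-trans (m∣m*n (2 ^ i)) (m∣m*n a)

2^*odd-injective : ∀ i j {a b} → ¬ 2 ∣ a → ¬ 2 ∣ b → 2 ^ i * a ≡ 2 ^ j * b → i ≡ j × a ≡ b
2^*odd-injective zero    zero    {a} {b} _   _   eq =
  refl , ≡-trans (sym (*-identityˡ a)) (≡-trans eq (*-identityˡ b))
2^*odd-injective zero    (suc j) {a} {b} 2∤a _   eq =
  contradiction (subst (2 ∣_) (≡-trans (sym eq) (*-identityˡ a)) (2∣2^suc* j b)) 2∤a
2^*odd-injective (suc i) zero    {a} {b} _   2∤b eq =
  contradiction (subst (2 ∣_) (≡-trans eq (*-identityˡ b)) (2∣2^suc* i a)) 2∤b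
2^*odd-injective (suc i) (suc j) {a} {b} 2∤a 2∤b eq
  with 2^*odd-injective i j 2∤a 2∤b (*-cancelˡ-≡ _ _ 2 halves)
  where
  halves : 2 * (2 ^ i * a) ≡ 2 * (2 ^ j * b)
  halves = ≡-trans (sym (*-assoc 2 (2 ^ i) a)) (≡-trans eq (*-assoc 2 (2 ^ j) b))
... | refl , a≡b = refl , a≡b

suc-C2 : ∀ n → suc n C 2 ≡ n + n C 2
suc-C2 n = ≡-trans (sym (nCk+nC[k+1]≡[n+1]C[k+1] n 1)) (cong (_+ n C 2) (nC1≡n n))

C2-<-mono : ∀ {m n} → 1 ≤ m → m < n → m C 2 < n C 2
C2-<-mono {m} {suc n} 1≤m (s≤s m≤n) with m≤n⇒m<n∨m≡n m≤n
... | inj₁ m<n  = <-≤-trans (C2-<-mono 1≤m m<n) (≤-trans (m≤n+m (n C 2) n) (≤-reflexive (sym (suc-C2 n))))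
... | inj₂ refl = <-≤-trans (m<n+m (m C 2) 1≤m) (≤-reflexive (sym (suc-C2 m)))

C2-injective : ∀ {m n} → 2 ≤ m → m C 2 ≡ n C 2 → m ≡ n
C2-injective {m} {n} 2≤m eq with <-cmp m n
... | tri< m<n _ _ = contradiction eq (<⇒≢ (C2-<-mono (≤-trans (s≤s z≤n) 2≤m) m<n))
... | tri≈ _ m≡n _ = m≡n
... | tri> _ _ n<m with n
...   | zero        = contradiction (sym eq) (<⇒≢ (C2-<-mono (s≤s z≤n) 2≤m))
...   | suc zero    = contradiction (sym eq) (<⇒≢ (C2-<-mono (s≤s z≤n) 2≤m))
...   | suc (suc k) = contradiction (sym eq) (<⇒≢ (C2-<-mono (s≤s z≤n) n<m))

C2-positive : ∀ {m} → 2 ≤ m → 1 ≤ m C 2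
C2-positive 2≤m = C2-<-mono (s≤s z≤n) 2≤m

C2-vanishing : ∀ {m} → ¬ (2 ≤ m) → m C 2 ≡ 0
C2-vanishing {zero}        _   = refl
C2-vanishing {suc zero}    _   = refl
C2-vanishing {suc (suc m)} 2≰m = contradiction (s≤s (s≤s z≤n)) 2≰m

-- Multiplicities

δ : ℕ → ℕ → ℕ
δ x v = if x ≡ᵇ v then 1 else 0

δ-refl : ∀ x → δ x x ≡ 1
δ-refl zero    = refl
δ-refl (suc x) = δ-refl x

δ-≢ : ∀ {x v} → x ≢ v → δ x v ≡ 0
δ-≢ {zero}  {zero}  x≢v = contradiction refl x≢v
δ-≢ {zero}  {suc v} x≢v = refl
δ-≢ {suc x} {zero}  x≢v = refl
δ-≢ {suc x} {suc v} x≢v = δ-≢ (λ x≡v → x≢v (cong suc x≡v))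

occurrences : ℕ → List ℕ → ℕ
occurrences v xs = sum (map (λ x → δ x v) xs)

m1≡occurrences : ∀ xs → m1 xs ≡ occurrences 1 xs
m1≡occurrences []       = refl
m1≡occurrences (x ∷ xs) = cong (δ x 1 +_) (m1≡occurrences xs)

occurrences-++ : ∀ v xs ys → occurrences v (xs ++ ys) ≡ occurrences v xs + occurrences v ys
occurrences-++ v xs ys =
  ≡-trans (cong sum (List.map-++ (λ x → δ x v) xs ys)) (sum-++ (map (λ x → δ x v) xs) _)

occurrences-↭ : ∀ v {xs ys} → xs ↭ ys → occurrences v xs ≡ occurrences v ys
occurrences-↭ v p = sum-↭ (Perm.map⁺ (λ x → δ x v) p)

occurrences-absent : ∀ v {xs} → All (_≢ v) xs → occurrences v xs ≡ 0
occurrences-absent v []           = refl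
occurrences-absent v (x≢v ∷ xs≢v) = cong₂ _+_ (δ-≢ x≢v) (occurrences-absent v xs≢v)

occurrences-replicate : ∀ c v → occurrences v (replicate c v) ≡ c
occurrences-replicate zero    v = refl
occurrences-replicate (suc c) v = cong₂ _+_ (δ-refl v) (occurrences-replicate c v)

occurrences-positive : ∀ v xs → 1 ≤ occurrences v xs → v ∈ xs
occurrences-positive v (x ∷ xs) pos with x ≟ v
... | yes refl = here refl
... | no  x≢v  = there (occurrences-positive v xs (subst (λ k → 1 ≤ k + occurrences v xs) (δ-≢ x≢v) pos))

occurrences-self : ∀ x xs → occurrences x (x ∷ xs) ≡ suc (occurrences x xs)
occurrences-self x xs = cong (_+ occurrences x xs) (δ-refl x)

↭-occurrences : ∀ xs ys → (∀ v → occurrences v xs ≡ occurrences v ys) → xs ↭ ys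
↭-occurrences []       []       same = ↭-refl
↭-occurrences []       (y ∷ ys) same = contradiction (≡-trans (same y) (occurrences-self y ys)) λ ()
↭-occurrences (x ∷ xs) ys       same
  with ∈-∃++ (occurrences-positive x ys
               (subst (1 ≤_) (≡-trans (sym (occurrences-self x xs)) (same x)) (s≤s z≤n)))
... | as , bs , refl = ↭-trans (prep x (↭-occurrences xs (as ++ bs) same′)) (↭-sym (Perm.shift x as bs))
  where
  same′ : ∀ v → occurrences v xs ≡ occurrences v (as ++ bs)
  same′ v = +-cancelˡ-≡ (δ x v) _ _ (≡-trans (same v) (occurrences-↭ v (Perm.shift x as bs)))

m1-↭ : ∀ {xs ys} → xs ↭ ys → m1 xs ≡ m1 ys
m1-↭ {xs} {ys} p = ≡-trans (m1≡occurrences xs) (≡-trans (occurrences-↭ 1 p) (sym (m1≡occurrences ys)))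

m1≤length : ∀ xs → m1 xs ≤ length xs
m1≤length []       = z≤n
m1≤length (x ∷ xs) with x ≟ 1
... | yes refl = s≤s (m1≤length xs)
... | no  x≢1  rewrite δ-≢ x≢1 = m≤n⇒m≤1+n (m1≤length xs)

m1-replicate-++ : ∀ c {p} xs → 2 ≤ p → m1 (replicate c p ++ xs) ≡ m1 xs
m1-replicate-++ zero    xs _                 = refl
m1-replicate-++ (suc c) xs 2≤p@(s≤s (s≤s _)) = m1-replicate-++ c xs 2≤p

-- Power series

-- shift e f = q^e · f
shift : ℕ → Series → Series
shift zero    f n       = f n
shift (suc e) f zero    = 0
shift (suc e) f (suc n) = shift e f n

shift-cong : ∀ e {f g : Series} n → (∀ m → m ≤ n → f m ≡ g m) → shift e f n ≡ shift e g n
shift-cong zero    n       eq = eq n ≤-refl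
shift-cong (suc e) zero    eq = refl
shift-cong (suc e) (suc n) eq = shift-cong e n (λ m m≤n → eq m (m≤n⇒m≤1+n m≤n))

shift-zero : ∀ e n → shift e (λ _ → 0) n ≡ 0
shift-zero zero    n       = refl
shift-zero (suc e) zero    = refl
shift-zero (suc e) (suc n) = shift-zero e n

shift-beyond : ∀ e (f : Series) {n} → n < e → shift e f n ≡ 0
shift-beyond (suc e) f {zero}  _         = refl
shift-beyond (suc e) f {suc n} (s≤s n<e) = shift-beyond e f n<e

shift-shift : ∀ a b (f : Series) n → shift b (shift a f) n ≡ shift (b + a) f n
shift-shift a zero    f n       = refl
shift-shift a (suc b) f zero    = refl
shift-shift a (suc b) f (suc n) = shift-shift a b f n

shift-+ : ∀ e (f g : Series) n → shift e (λ m → f m + g m) n ≡ shift e f n + shift e g n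
shift-+ zero    f g n       = refl
shift-+ (suc e) f g zero    = refl
shift-+ (suc e) f g (suc n) = shift-+ e f g n

shift-∑ : ∀ e (h : ℕ → Series) k n → shift e (λ m → ∑[ c < k ] h c m) n ≡ ∑[ c < k ] shift e (h c) n
shift-∑ zero    h k n       = refl
shift-∑ (suc e) h k zero    = sym (∑-zero k (λ _ → refl))
shift-∑ (suc e) h k (suc n) = shift-∑ e h k n

shift-+2 : ∀ e (f g : Series) n → (∀ m → m ≤ n → f m ≡ g (2 + m)) → g 0 ≡ 0 → g 1 ≡ 0 →
           shift e f n ≡ shift e g (2 + n)
shift-+2 zero                f g n       eq g0 g1 = eq n ≤-refl
shift-+2 (suc zero)          f g zero    eq g0 g1 = sym g1
shift-+2 (suc (suc zero))    f g zero    eq g0 g1 = sym g0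
shift-+2 (suc (suc (suc e))) f g zero    eq g0 g1 = refl
shift-+2 (suc e)             f g (suc n) eq g0 g1 =
  shift-+2 e f g n (λ m m≤n → eq m (m≤n⇒m≤1+n m≤n)) g0 g1

shift-δ : ∀ e k n → shift e (δ k) n ≡ δ (e + k) n
shift-δ zero    k n       = refl
shift-δ (suc e) k zero    = refl
shift-δ (suc e) k (suc n) = shift-δ e k n

∑-δ-shift : ∀ e (f : Series) n → ∑[ k < suc n ] (δ k e * f (n ∸ k)) ≡ shift e f n
∑-δ-shift zero    f n       =
  ≡-trans (cong₂ _+_ (+-identityʳ (f n)) (∑-zero n (λ _ → refl))) (+-identityʳ (f n))
∑-δ-shift (suc e) f zero    = refl
∑-δ-shift (suc e) f (suc n) = ∑-δ-shift e f n

onePlusQ-⊛ : ∀ e (f : Series) n → (onePlusQ e ⊛ f) n ≡ f n + shift e f n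
onePlusQ-⊛ e f n = begin
  sum (map (λ k → onePlusQ e k * f (n ∸ k)) (upTo (suc n)))
    ≡⟨ sum-map-upTo _ (suc n) ⟩
  ∑[ k < suc n ] (onePlusQ e k * f (n ∸ k))
    ≡⟨ ∑-cong (suc n) (λ k _ → *-distribʳ-+ (f (n ∸ k)) (δ k 0) (δ k e)) ⟩
  ∑[ k < suc n ] (δ k 0 * f (n ∸ k) + δ k e * f (n ∸ k))
    ≡⟨ ∑-distrib-+ (λ k → δ k 0 * f (n ∸ k)) (λ k → δ k e * f (n ∸ k)) (suc n) ⟩
  ∑[ k < suc n ] (δ k 0 * f (n ∸ k)) + ∑[ k < suc n ] (δ k e * f (n ∸ k))
    ≡⟨ cong₂ _+_ (∑-δ-shift 0 f n) (∑-δ-shift e f n) ⟩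
  f n + shift e f n ∎
  where open ≡-Reasoning

⊛-congʳ : ∀ (f : Series) {g h : Series} → g ≗ h → (f ⊛ g) ≗ (f ⊛ h)
⊛-congʳ f g≗h n = cong sum (List.map-cong (λ k → cong (f k *_) (g≗h (n ∸ k))) (upTo (suc n)))

prodS-∷ : ∀ e es n → prodS (e ∷ es) n ≡ prodS es n + shift e (prodS es) n
prodS-∷ e es = onePlusQ-⊛ e (prodS es)

prodS-∷∷ : ∀ x y zs n → let F = prodS zs in
           prodS (x ∷ y ∷ zs) n ≡ (F n + shift y F n) + (shift x F n + shift (x + y) F n)
prodS-∷∷ x y zs n = begin
  prodS (x ∷ y ∷ zs) n
    ≡⟨ prodS-∷ x (y ∷ zs) n ⟩
  prodS (y ∷ zs) n + shift x (prodS (y ∷ zs)) n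
    ≡⟨ cong₂ _+_ (prodS-∷ y zs n) (shift-cong x n (λ m _ → prodS-∷ y zs m)) ⟩
  (F n + shift y F n) + shift x (λ m → F m + shift y F m) n
    ≡⟨ cong ((F n + shift y F n) +_) (≡-trans (shift-+ x F (shift y F) n)
                                               (cong (shift x F n +_) (shift-shift y x F n))) ⟩
  (F n + shift y F n) + (shift x F n + shift (x + y) F n) ∎
  where
  open ≡-Reasoning
  F : Series
  F = prodS zs

prodS-swap : ∀ x y zs n → prodS (x ∷ y ∷ zs) n ≡ prodS (y ∷ x ∷ zs) n
prodS-swap x y zs n = begin
  prodS (x ∷ y ∷ zs) n
    ≡⟨ prodS-∷∷ x y zs n ⟩
  (F n + shift y F n) + (shift x F n + shift (x + y) F n)
    ≡⟨ interchange (F n) _ _ _ ⟩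
  (F n + shift x F n) + (shift y F n + shift (x + y) F n)
    ≡⟨ cong (λ e → (F n + shift x F n) + (shift y F n + shift e F n)) (+-comm x y) ⟩
  (F n + shift x F n) + (shift y F n + shift (y + x) F n)
    ≡⟨ prodS-∷∷ y x zs n ⟨
  prodS (y ∷ x ∷ zs) n ∎
  where
  open ≡-Reasoning
  F : Series
  F = prodS zs

prodS-↭ : ∀ {xs ys} → xs ↭ ys → prodS xs ≗ prodS ys
prodS-↭ refl         n = refl
prodS-↭ (prep x p)   n = ⊛-congʳ (onePlusQ x) (prodS-↭ p) n
prodS-↭ (swap {xs} x y p) n = ≡-trans (prodS-swap x y xs n)
  (⊛-congʳ (onePlusQ y) (⊛-congʳ (onePlusQ x) (prodS-↭ p)) n)
prodS-↭ (trans p q)  n = ≡-trans (prodS-↭ p n) (prodS-↭ q n)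

prodS-filter : ∀ n es {m} → m ≤ n → prodS (filter (_≤? n) es) m ≡ prodS es m
prodS-filter n []       m≤n = refl
prodS-filter n (e ∷ es) {m} m≤n with e ≤? n
... | yes e≤n rewrite List.filter-accept (_≤? n) {e} {es} e≤n =
  ≡-trans (prodS-∷ e (filter (_≤? n) es) m)
    (≡-trans (cong₂ _+_ (prodS-filter n es m≤n)
                        (shift-cong e m (λ k k≤m → prodS-filter n es (≤-trans k≤m m≤n))))
             (sym (prodS-∷ e es m)))
... | no e≰n rewrite List.filter-reject (_≤? n) {e} {es} e≰n = begin
  prodS (filter (_≤? n) es) m        ≡⟨ prodS-filter n es m≤n ⟩
  prodS es m                         ≡⟨ +-identityʳ _ ⟨
  prodS es m + 0                     ≡⟨ cong (prodS es m +_) (shift-beyond e (prodS es) m<e) ⟨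
  prodS es m + shift e (prodS es) m  ≡⟨ prodS-∷ e es m ⟨
  prodS (e ∷ es) m                   ∎
  where
  open ≡-Reasoning
  m<e : m < e
  m<e = ≤-<-trans m≤n (≰⇒> e≰n)

module _ {A : Set} where

  shiftL : ℕ → (ℕ → List A) → ℕ → List A
  shiftL zero    F n       = F n
  shiftL (suc e) F zero    = []
  shiftL (suc e) F (suc n) = shiftL e F n

  ∈-shiftL⁻ : ∀ e F n {x} → x ∈ shiftL e F n → e ≤ n × x ∈ F (n ∸ e)
  ∈-shiftL⁻ zero    F n       x∈ = z≤n , x∈
  ∈-shiftL⁻ (suc e) F (suc n) x∈ with ∈-shiftL⁻ e F n x∈
  ... | e≤n , x∈′ = s≤s e≤n , x∈′

  ∈-shiftL⁺ : ∀ e F {n x} → e ≤ n → x ∈ F (n ∸ e) → x ∈ shiftL e F n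
  ∈-shiftL⁺ zero    F z≤n       x∈ = x∈
  ∈-shiftL⁺ (suc e) F (s≤s e≤n) x∈ = ∈-shiftL⁺ e F e≤n x∈

  shiftL-unique : ∀ e F n → (∀ m → Unique (F m)) → Unique (shiftL e F n)
  shiftL-unique zero    F n       F! = F! n
  shiftL-unique (suc e) F zero    F! = []
  shiftL-unique (suc e) F (suc n) F! = shiftL-unique e F n F!

  sum-map-shiftL : ∀ (f : A → ℕ) e F n → sum (map f (shiftL e F n)) ≡ shift e (λ m → sum (map f (F m))) n
  sum-map-shiftL f zero    F n       = refl
  sum-map-shiftL f (suc e) F zero    = refl
  sum-map-shiftL f (suc e) F (suc n) = sum-map-shiftL f e F n

doublings : ℕ → ℕ → List ℕ
doublings p zero    = []
doublings p (suc k) = p ∷ doublings (2 * p) k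

prodS-doublings : ∀ p k rest n →
  prodS (doublings p k ++ rest) n ≡ ∑[ c < 2 ^ k ] shift (c * p) (prodS rest) n
prodS-doublings p zero    rest n = sym (+-identityʳ _)
prodS-doublings p (suc k) rest n = begin
  prodS (p ∷ doublings (2 * p) k ++ rest) n
    ≡⟨ prodS-∷ p (doublings (2 * p) k ++ rest) n ⟩
  prodS (doublings (2 * p) k ++ rest) n + shift p (prodS (doublings (2 * p) k ++ rest)) n
    ≡⟨ cong₂ _+_ (prodS-doublings (2 * p) k rest n)
                 (shift-cong p n (λ m _ → prodS-doublings (2 * p) k rest m)) ⟩
  ∑[ c < 2 ^ k ] shift (c * (2 * p)) F n + shift p (λ m → ∑[ c < 2 ^ k ] shift (c * (2 * p)) F m) n
    ≡⟨ cong (∑[ c < 2 ^ k ] shift (c * (2 * p)) F n +_)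
            (shift-∑ p (λ c → shift (c * (2 * p)) F) (2 ^ k) n) ⟩
  ∑[ c < 2 ^ k ] shift (c * (2 * p)) F n + ∑[ c < 2 ^ k ] shift p (shift (c * (2 * p)) F) n
    ≡⟨ cong₂ _+_ (∑-cong (2 ^ k) (λ c _ → cong (λ e → shift e F n) (even c)))
                 (∑-cong (2 ^ k) (λ c _ → ≡-trans (shift-shift (c * (2 * p)) p F n)
                                                  (cong (λ e → shift (p + e) F n) (even c)))) ⟩
  ∑[ c < 2 ^ k ] shift (2 * c * p) F n + ∑[ c < 2 ^ k ] shift (suc (2 * c) * p) F n
    ≡⟨ ∑-evens-odds (λ c → shift (c * p) F n) (2 ^ k) ⟨
  ∑[ c < 2 ^ suc k ] shift (c * p) F n ∎
  where
  open ≡-Reasoning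
  F : Series
  F = prodS rest
  even : ∀ c → c * (2 * p) ≡ 2 * c * p
  even c = ≡-trans (sym (*-assoc c 2 p)) (cong (_* p) (*-comm c 2))

-- geometric p f = f / (1 − q^p) when p ≥ 1
geometric : ℕ → Series → Series
geometric p f n = ∑[ c < suc n ] shift (c * p) f n

geometric-cong : ∀ p {f g : Series} n → (∀ m → m ≤ n → f m ≡ g m) → geometric p f n ≡ geometric p g n
geometric-cong p n eq = ∑-cong (suc n) (λ c _ → shift-cong (c * p) n eq)

shift-multiple-beyond : ∀ {p c n} (f : Series) → 1 ≤ p → n < c → shift (c * p) f n ≡ 0
shift-multiple-beyond {p} {c} f 1≤p n<c = shift-beyond (c * p) f (<-≤-trans n<c (m≤m*n c p {{>-nonZero 1≤p}}))

prodS-doublings-geometric : ∀ p k rest {n} → 1 ≤ p → n < 2 ^ k →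
  prodS (doublings p k ++ rest) n ≡ geometric p (prodS rest) n
prodS-doublings-geometric p k rest {n} 1≤p n<2^k =
  ≡-trans (prodS-doublings p k rest n)
          (∑-truncate (λ c → shift (c * p) (prodS rest) n)
                      (λ c → shift-multiple-beyond (prodS rest) 1≤p) n<2^k)

geometric-one-oneS : ∀ n → geometric 1 oneS n ≡ 1
geometric-one-oneS zero    = refl
geometric-one-oneS (suc n) = geometric-one-oneS n

geometric-one-const : ∀ n → geometric 1 (λ _ → 1) n ≡ suc n
geometric-one-const zero    = refl
geometric-one-const (suc n) = cong suc (geometric-one-const n)

geometric-one-suc : ∀ n → geometric 1 suc n ≡ (2 + n) C 2
geometric-one-suc zero    = refl
geometric-one-suc (suc n) = ≡-trans (cong (2 + n +_) (geometric-one-suc n)) (sym (suc-C2 (2 + n)))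

prodS-three-doublings : ∀ k {n} → n < 2 ^ k →
  prodS (doublings 1 k ++ doublings 1 k ++ doublings 1 k) n ≡ (2 + n) C 2
prodS-three-doublings k {n} n<2^k = begin
  prodS (ones ++ ones ++ ones) n  ≡⟨ prodS-doublings-geometric 1 k (ones ++ ones) ≤-refl n<2^k ⟩
  geometric 1 (prodS (ones ++ ones)) n
    ≡⟨ geometric-cong 1 n (λ m m≤n → two m (≤-<-trans m≤n n<2^k)) ⟩
  geometric 1 suc n               ≡⟨ geometric-one-suc n ⟩
  (2 + n) C 2                     ∎
  where
  open ≡-Reasoning
  ones : List ℕ
  ones = doublings 1 k
  one : ∀ m → m < 2 ^ k → prodS ones m ≡ 1
  one m m<2^k = begin
    prodS ones m          ≡⟨ cong (λ es → prodS es m) (List.++-identityʳ ones) ⟨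
    prodS (ones ++ []) m  ≡⟨ prodS-doublings-geometric 1 k [] ≤-refl m<2^k ⟩
    geometric 1 oneS m    ≡⟨ geometric-one-oneS m ⟩
    1                     ∎
  two : ∀ m → m < 2 ^ k → prodS (ones ++ ones) m ≡ suc m
  two m m<2^k = begin
    prodS (ones ++ ones) m         ≡⟨ prodS-doublings-geometric 1 k ones ≤-refl m<2^k ⟩
    geometric 1 (prodS ones) m
      ≡⟨ geometric-cong 1 m (λ j j≤m → one j (≤-<-trans j≤m m<2^k)) ⟩
    geometric 1 (λ _ → 1) m        ≡⟨ geometric-one-const m ⟩
    suc m                          ∎

-- q²/(1 − q)³ · ∏_{1≤j≤e} 1/(1 − q^{D^j}), the generating function of Σ C(m₁ λ, 2) over the
-- D-ary partitions λ with parts ≤ D^e.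
pairsOfOnes : ℕ → ℕ → Series
pairsOfOnes D zero    n = n C 2
pairsOfOnes D (suc e)   = geometric (D ^ suc e) (pairsOfOnes D e)

pairsOfOnes-<2 : ∀ D e {n} → n < 2 → pairsOfOnes D e n ≡ 0
pairsOfOnes-<2 D zero    {zero}  _ = refl
pairsOfOnes-<2 D zero    {suc zero} _ = refl
pairsOfOnes-<2 D zero    {suc (suc n)} (s≤s (s≤s ()))
pairsOfOnes-<2 D (suc e) {n} n<2 = ∑-zero (suc n) (λ c → ≡-trans
  (shift-cong (c * D ^ suc e) n (λ m m≤n → pairsOfOnes-<2 D e (≤-<-trans m≤n n<2)))
  (shift-zero (c * D ^ suc e) n))

-- In degrees < 2^k, the three blocks doublings 1 k expand 1/(1 − q)³ and doublings (D^j) k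
-- expands 1/(1 − q^{D^j}).
exponentBlocks : ℕ → ℕ → ℕ → List ℕ
exponentBlocks D k zero    = doublings 1 k ++ doublings 1 k ++ doublings 1 k
exponentBlocks D k (suc e) = doublings (D ^ suc e) k ++ exponentBlocks D k e

prodS-exponentBlocks : ∀ {D} e {n m} → 1 ≤ D → m ≤ n →
  prodS (exponentBlocks D (suc n) e) m ≡ pairsOfOnes D e (2 + m)
prodS-exponentBlocks zero {n} {m} _ m≤n = prodS-three-doublings (suc n) (<-trans (s≤s m≤n) (n<2^n (suc n)))
prodS-exponentBlocks {D} (suc e) {n} {m} 1≤D m≤n = begin
  prodS (doublings P (suc n) ++ exponentBlocks D (suc n) e) m
    ≡⟨ prodS-doublings-geometric P (suc n) _ 1≤P (<-trans (s≤s m≤n) (n<2^n (suc n))) ⟩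
  ∑[ c < suc m ] shift (c * P) F m
    ≡⟨ ∑-truncate (λ c → shift (c * P) F m) (λ c → shift-multiple-beyond F 1≤P) (m≤n+m (suc m) 2) ⟨
  ∑[ c < 3 + m ] shift (c * P) F m
    ≡⟨ ∑-cong (3 + m) (λ c _ → shift-+2 (c * P) F (pairsOfOnes D e) m
         (λ j j≤m → prodS-exponentBlocks e 1≤D (≤-trans j≤m m≤n))
         (pairsOfOnes-<2 D e (s≤s z≤n)) (pairsOfOnes-<2 D e (s≤s (s≤s z≤n)))) ⟩
  pairsOfOnes D (suc e) (2 + m) ∎
  where
  open ≡-Reasoning
  P : ℕ
  P = D ^ suc e
  F : Series
  F = prodS (exponentBlocks D (suc n) e)
  1≤P : 1 ≤ P
  1≤P = m^n>0 D {{>-nonZero 1≤D}} (suc e)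

map-upTo-doublings : ∀ p k (f : ℕ → ℕ) → (∀ i → f i ≡ 2 ^ i * p) → map f (upTo k) ≡ doublings p k
map-upTo-doublings p k f f≗ = ≡-trans (List.map-upTo f k) (go p k f f≗)
  where
  go : ∀ p k (f : ℕ → ℕ) → (∀ i → f i ≡ 2 ^ i * p) → applyUpTo f k ≡ doublings p k
  go p zero    f f≗ = refl
  go p (suc k) f f≗ = cong₂ _∷_ (≡-trans (f≗ 0) (+-identityʳ p)) (go (2 * p) k (λ i → f (suc i))
    (λ i → ≡-trans (f≗ (suc i)) (≡-trans (cong (_* p) (*-comm 2 (2 ^ i))) (*-assoc (2 ^ i) 2 p))))

exponentBlocks-↭ : ∀ D k e →
  concatMap (λ j → doublings (D ^ j) k) (upTo (suc e)) ++ doublings 1 k ++ doublings 1 k ↭ exponentBlocks D k e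
exponentBlocks-↭ D k zero    =
  ↭-reflexive (cong (_++ doublings 1 k ++ doublings 1 k) (List.++-identityʳ (doublings 1 k)))
exponentBlocks-↭ D k (suc e) = begin
  concatMap block (upTo (suc (suc e))) ++ extraTwos
    ↭⟨ Perm.++⁺ʳ extraTwos (concatMap-upTo-suc block (suc e)) ⟩
  (block (suc e) ++ concatMap block (upTo (suc e))) ++ extraTwos
    ≡⟨ List.++-assoc (block (suc e)) _ extraTwos ⟩
  block (suc e) ++ concatMap block (upTo (suc e)) ++ extraTwos
    ↭⟨ Perm.++⁺ˡ (block (suc e)) (exponentBlocks-↭ D k e) ⟩
  block (suc e) ++ exponentBlocks D k e ∎
  where
  open PermutationReasoning
  block : ℕ → List ℕ
  block j = doublings (D ^ j) k
  extraTwos : List ℕ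
  extraTwos = doublings 1 k ++ doublings 1 k

allExponents : ℕ → ℕ → List ℕ
allExponents d n =
  concatMap (λ i → 2 ^ i ∷ 2 ^ i ∷ []) (upTo (suc n))
  ++ concatMap (λ i → map (λ j → 2 ^ i * (2 * d + 1) ^ j) (upTo (suc n))) (upTo (suc n))

allExponents-↭ : ∀ d n → allExponents d n ↭ exponentBlocks (2 * d + 1) (suc n) n
allExponents-↭ d n = begin
  concatMap (λ i → 2 ^ i ∷ [ 2 ^ i ]) I ++ X
    ↭⟨ Perm.++⁺ʳ X (concatMap-∷ (2 ^_) (λ i → [ 2 ^ i ]) I) ⟩
  (map (2 ^_) I ++ concatMap (λ i → [ 2 ^ i ]) I) ++ X
    ≡⟨ cong (λ ys → (map (2 ^_) I ++ ys) ++ X)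
            (≡-trans (sym (List.concatMap-map [_] (2 ^_) I)) (List.concatMap-pure (map (2 ^_) I))) ⟩
  (map (2 ^_) I ++ map (2 ^_) I) ++ X
    ≡⟨ cong (λ ys → (ys ++ ys) ++ X) (map-upTo-doublings 1 (suc n) (2 ^_) (sym ∘ *-identityʳ ∘ (2 ^_))) ⟩
  extraTwos ++ X
    ↭⟨ Perm.++⁺ˡ extraTwos (concatMap-transpose (λ i j → 2 ^ i * D ^ j) I I) ⟩
  extraTwos ++ concatMap (λ j → map (λ i → 2 ^ i * D ^ j) I) I
    ≡⟨ cong (extraTwos ++_)
            (List.concatMap-cong (λ j → map-upTo-doublings (D ^ j) (suc n) _ (λ _ → refl)) I) ⟩
  extraTwos ++ concatMap (λ j → doublings (D ^ j) (suc n)) I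
    ↭⟨ Perm.++-comm extraTwos _ ⟩
  concatMap (λ j → doublings (D ^ j) (suc n)) I ++ extraTwos
    ↭⟨ exponentBlocks-↭ D (suc n) n ⟩
  exponentBlocks D (suc n) n ∎
  where
  open PermutationReasoning
  D : ℕ
  D = 2 * d + 1
  I : List ℕ
  I = upTo (suc n)
  X : List ℕ
  X = concatMap (λ i → map (λ j → 2 ^ i * D ^ j) I) I
  extraTwos : List ℕ
  extraTwos = doublings 1 (suc n) ++ doublings 1 (suc n)

infProdCoef-pairsOfOnes : ∀ d n → infProdCoef d n ≡ pairsOfOnes (2 * d + 1) n (2 + n)
infProdCoef-pairsOfOnes d n = begin
  prodS (filter (_≤? n) (allExponents d n)) n  ≡⟨ prodS-filter n (allExponents d n) ≤-refl ⟩
  prodS (allExponents d n) n                   ≡⟨ prodS-↭ (allExponents-↭ d n) n ⟩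
  prodS (exponentBlocks D (suc n) n) n         ≡⟨ prodS-exponentBlocks n (m≤n+m 1 (2 * d)) ≤-refl ⟩
  pairsOfOnes D n (2 + n)                      ∎
  where
  open ≡-Reasoning
  D : ℕ
  D = 2 * d + 1

rhsCoef-pairsOfOnes : ∀ d n → rhsCoef d n ≡ pairsOfOnes (2 * d + 1) (n ∸ 2) n
rhsCoef-pairsOfOnes d zero          = refl
rhsCoef-pairsOfOnes d (suc zero)    = refl
rhsCoef-pairsOfOnes d (suc (suc n)) = infProdCoef-pairsOfOnes d n

-- D-ary partitions

mutual
  daryPartitions : ℕ → ℕ → ℕ → List (List ℕ)
  daryPartitions D zero    n = [ replicate n 1 ]
  daryPartitions D (suc e) n = concatMap (withTopParts D e n) (upTo (suc n))

  withTopParts : ℕ → ℕ → ℕ → ℕ → List (List ℕ)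
  withTopParts D e n c =
    shiftL (c * D ^ suc e) (λ m → map (replicate c (D ^ suc e) ++_) (daryPartitions D e m)) n

module DaryPartitions (D : ℕ) (1<D : 1 < D) where

  instance
    D≢0 : NonZero D
    D≢0 = >-nonZero (<-trans (s≤s z≤n) 1<D)

  ∈-withTopParts⁻ : ∀ e n c {xs} → xs ∈ withTopParts D e n c →
    ∃[ ys ] xs ≡ replicate c (D ^ suc e) ++ ys × c * D ^ suc e ≤ n
          × ys ∈ daryPartitions D e (n ∸ c * D ^ suc e)
  ∈-withTopParts⁻ e n c xs∈ with ∈-shiftL⁻ (c * D ^ suc e) _ n xs∈
  ... | cP≤n , xs∈′ with ∈-map⁻ (replicate c (D ^ suc e) ++_) xs∈′
  ...   | ys , ys∈ , refl = ys , refl , cP≤n , ys∈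

  sound : ∀ e n {xs} → xs ∈ daryPartitions D e n → IsDaryPartition D n xs × All (_≤ D ^ e) xs
  sound zero    n (here refl) =
    (ones↘ n , All.replicate⁺ n (0 , refl) , ≡-trans (sum-replicate n 1) (*-identityʳ n))
    , All.replicate⁺ n ≤-refl
    where
    ones↘ : ∀ n → Linked _≥_ (replicate n 1)
    ones↘ zero          = []
    ones↘ (suc zero)    = [-]
    ones↘ (suc (suc n)) = ≤-refl ∷ ones↘ (suc n)
  sound (suc e) n xs∈ with find (∈-concatMap⁻ (withTopParts D e n) {xs = upTo (suc n)} xs∈)
  ... | c , _ , xs∈c with ∈-withTopParts⁻ e n c xs∈c
  ...   | ys , refl , cP≤n , ys∈ with sound e (n ∸ c * D ^ suc e) ys∈
  ...     | (ys↘ , ys-pow , ys-sum) , ys≤ =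
    ( Linked-replicate-++ c ys≤P ys↘
    , All.++⁺ (All.replicate⁺ c (suc e , refl)) ys-pow
    , (begin
        sum (replicate c P ++ ys)       ≡⟨ sum-++ (replicate c P) ys ⟩
        sum (replicate c P) + sum ys    ≡⟨ cong₂ _+_ (sum-replicate c P) ys-sum ⟩
        c * P + (n ∸ c * P)             ≡⟨ m+[n∸m]≡n cP≤n ⟩
        n                               ∎) )
    , All.++⁺ (All.replicate⁺ c ≤-refl) ys≤P
    where
    open ≡-Reasoning
    P : ℕ
    P = D ^ suc e
    ys≤P : All (_≤ P) ys
    ys≤P = All.map (λ y≤ → ≤-trans y≤ (^-monoʳ-≤ D (n≤1+n e))) ys≤

  private
    power-cancel : ∀ e {x} → IsPowerOf D x → x < D ^ suc e → x ≤ D ^ e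
    power-cancel e (k , refl) lt = ^-monoʳ-≤ D (≤-pred (^-cancelʳ-< D {k} {suc e} lt))

    ones : ∀ xs → All (IsPowerOf D) xs → All (_≤ 1) xs → xs ≡ replicate (sum xs) 1
    ones []       []                []           = refl
    ones (x ∷ xs) ((k , refl) ∷ xs-pow) (x≤1 ∷ xs≤1) rewrite ≤-antisym x≤1 (m^n>0 D k) =
      cong (1 ∷_) (ones xs xs-pow xs≤1)

    drop-replicate : ∀ c {p ys} → Linked _≥_ (replicate c p ++ ys) → Linked _≥_ ys
    drop-replicate zero    ys↘ = ys↘
    drop-replicate (suc c) ys↘ = drop-replicate c (Linked.tail ys↘)

  complete : ∀ e n {xs} → IsDaryPartition D n xs → All (_≤ D ^ e) xs → xs ∈ daryPartitions D e n
  complete zero n {xs} (_ , xs-pow , refl) xs≤1 = here (ones xs xs-pow xs≤1)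
  complete (suc e) n {xs} (xs↘ , xs-pow , xs-sum) xs≤P with span-replicate (D ^ suc e) xs↘ xs≤P
  ... | c , ys , refl , ys<P =
    ∈-concatMap⁺ (withTopParts D e n) (lose (∈-upTo⁺ (s≤s c≤n))
      (∈-shiftL⁺ (c * P) _ cP≤n (∈-map⁺ (replicate c P ++_) ys∈)))
    where
    P : ℕ
    P = D ^ suc e
    cP+ys : c * P + sum ys ≡ n
    cP+ys = ≡-trans (cong (_+ sum ys) (sym (sum-replicate c P)))
                    (≡-trans (sym (sum-++ (replicate c P) ys)) xs-sum)
    cP≤n : c * P ≤ n
    cP≤n = ≤-trans (m≤m+n (c * P) (sum ys)) (≤-reflexive cP+ys)
    c≤n : c ≤ n
    c≤n = ≤-trans (m≤m*n c P {{m^n≢0 D (suc e)}}) cP≤n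
    ys-pow : All (IsPowerOf D) ys
    ys-pow = All.++⁻ʳ (replicate c P) xs-pow
    ys∈ : ys ∈ daryPartitions D e (n ∸ c * P)
    ys∈ = complete e (n ∸ c * P)
      (drop-replicate c xs↘ , ys-pow , ≡-trans (sym (m+n∸m≡n (c * P) (sum ys))) (cong (_∸ c * P) cP+ys))
      (All.zipWith (λ (y-pow , y<P) → power-cancel e y-pow y<P) (ys-pow , ys<P))

  unique : ∀ e n → Unique (daryPartitions D e n)
  unique zero    n = [] ∷ []
  unique (suc e) n = Unique-concatMap (withTopParts D e n) (Unique.upTo⁺ (suc n))
    (λ c → shiftL-unique (c * P) _ n (λ m → Unique.map⁺ (List.++-cancelˡ (replicate c P) _ _) (unique e m)))
    (λ xs∈c xs∈c′ → ≡-trans (sym (multiplicity xs∈c)) (multiplicity xs∈c′))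
    where
    P : ℕ
    P = D ^ suc e
    multiplicity : ∀ {c xs} → xs ∈ withTopParts D e n c → occurrences P xs ≡ c
    multiplicity {c} xs∈ with ∈-withTopParts⁻ e n c xs∈
    ... | ys , refl , _ , ys∈ = begin
      occurrences P (replicate c P ++ ys)
        ≡⟨ occurrences-++ P (replicate c P) ys ⟩
      occurrences P (replicate c P) + occurrences P ys
        ≡⟨ cong₂ _+_ (occurrences-replicate c P) (occurrences-absent P ys≢P) ⟩
      c + 0
        ≡⟨ +-identityʳ c ⟩
      c ∎
      where
      open ≡-Reasoning
      ys≢P : All (_≢ P) ys
      ys≢P = All.map (λ y≤ → <⇒≢ (≤-<-trans y≤ (^-monoʳ-< D 1<D (n<1+n e)))) (proj₂ (sound e _ ys∈))

  sum-m1C2 : ∀ e n → sum (map (λ xs → m1 xs C 2) (daryPartitions D e n)) ≡ pairsOfOnes D e n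
  sum-m1C2 zero    n = ≡-trans (+-identityʳ _)
    (cong (_C 2) (≡-trans (m1≡occurrences (replicate n 1)) (occurrences-replicate n 1)))
  sum-m1C2 (suc e) n = begin
    sum (map w (concatMap (withTopParts D e n) (upTo (suc n))))
      ≡⟨ sum-map-concatMap w (withTopParts D e n) (upTo (suc n)) ⟩
    sum (map (λ c → sum (map w (withTopParts D e n c))) (upTo (suc n)))
      ≡⟨ sum-map-upTo _ (suc n) ⟩
    ∑[ c < suc n ] sum (map w (withTopParts D e n c))
      ≡⟨ ∑-cong (suc n) (λ c _ → ≡-trans (sum-map-shiftL w (c * P) (withCopies c) n)
                                         (shift-cong (c * P) n (λ m _ → copies c m))) ⟩
    pairsOfOnes D (suc e) n ∎
    where
    open ≡-Reasoning
    P : ℕ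
    P = D ^ suc e
    w : List ℕ → ℕ
    w xs = m1 xs C 2
    2≤P : 2 ≤ P
    2≤P = ≤-trans 1<D (≤-trans (≤-reflexive (sym (*-identityʳ D))) (^-monoʳ-≤ D (s≤s (z≤n {e}))))
    withCopies : ℕ → ℕ → List (List ℕ)
    withCopies c m = map (replicate c P ++_) (daryPartitions D e m)
    copies : ∀ c m → sum (map w (withCopies c m)) ≡ pairsOfOnes D e m
    copies c m = begin
      sum (map w (withCopies c m))
        ≡⟨ cong sum (List.map-∘ (daryPartitions D e m)) ⟨
      sum (map (λ xs → w (replicate c P ++ xs)) (daryPartitions D e m))
        ≡⟨ cong sum (List.map-cong (λ xs → cong (_C 2) (m1-replicate-++ c xs 2≤P)) (daryPartitions D e m)) ⟩
      sum (map w (daryPartitions D e m)) ≡⟨ sum-m1C2 e m ⟩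
      pairsOfOnes D e m ∎

-- Pairwise products

δ-*-one : ∀ x y → δ (x * y) 1 ≡ δ x 1 * δ y 1
δ-*-one x y with x ≟ 1 | y ≟ 1
... | yes refl | yes refl = refl
... | no x≢1   | _        rewrite δ-≢ x≢1 = δ-≢ (x≢1 ∘ m*n≡1⇒m≡1 x y)
... | yes refl | no y≢1   rewrite δ-≢ y≢1 = δ-≢ (y≢1 ∘ m*n≡1⇒m≡1 y 1 ∘ ≡-trans (*-comm y 1))

occurrences-one-map-* : ∀ x ys → occurrences 1 (map (x *_) ys) ≡ δ x 1 * occurrences 1 ys
occurrences-one-map-* x []       = sym (*-zeroʳ (δ x 1))
occurrences-one-map-* x (y ∷ ys) = begin
  δ (x * y) 1 + occurrences 1 (map (x *_) ys)   ≡⟨ cong₂ _+_ (δ-*-one x y) (occurrences-one-map-* x ys) ⟩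
  δ x 1 * δ y 1 + δ x 1 * occurrences 1 ys      ≡⟨ *-distribˡ-+ (δ x 1) (δ y 1) _ ⟨
  δ x 1 * (δ y 1 + occurrences 1 ys)            ∎
  where open ≡-Reasoning

occurrences-one-pairProducts : ∀ xs → occurrences 1 (pairProducts xs) ≡ occurrences 1 xs C 2
occurrences-one-pairProducts []       = refl
occurrences-one-pairProducts (x ∷ xs) = begin
  occurrences 1 (map (x *_) xs ++ pairProducts xs)
    ≡⟨ occurrences-++ 1 (map (x *_) xs) (pairProducts xs) ⟩
  occurrences 1 (map (x *_) xs) + occurrences 1 (pairProducts xs)
    ≡⟨ cong₂ _+_ (occurrences-one-map-* x xs) (occurrences-one-pairProducts xs) ⟩
  δ x 1 * k + k C 2
    ≡⟨ choose x ⟩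
  (δ x 1 + k) C 2 ∎
  where
  open ≡-Reasoning
  k : ℕ
  k = occurrences 1 xs
  choose : ∀ x → δ x 1 * k + k C 2 ≡ (δ x 1 + k) C 2
  choose x with x ≟ 1
  ... | yes refl = ≡-trans (cong (_+ k C 2) (+-identityʳ k)) (sym (suc-C2 k))
  ... | no  x≢1  rewrite δ-≢ x≢1 = refl

m1-pairProducts : ∀ xs → m1 (pairProducts xs) ≡ m1 xs C 2
m1-pairProducts xs = begin
  m1 (pairProducts xs)               ≡⟨ m1≡occurrences (pairProducts xs) ⟩
  occurrences 1 (pairProducts xs)    ≡⟨ occurrences-one-pairProducts xs ⟩
  occurrences 1 xs C 2               ≡⟨ cong (_C 2) (m1≡occurrences xs) ⟨
  m1 xs C 2                          ∎
  where open ≡-Reasoning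

pairProducts-↭ : ∀ {xs ys} → xs ↭ ys → pairProducts xs ↭ pairProducts ys
pairProducts-↭ refl         = ↭-refl
pairProducts-↭ (prep x p)   = Perm.++⁺ (Perm.map⁺ (x *_) p) (pairProducts-↭ p)
pairProducts-↭ (swap {xs} {ys} x y p) = begin
  x * y ∷ map (x *_) xs ++ map (y *_) xs ++ pairProducts xs
    ≡⟨ cong (_∷ map (x *_) xs ++ map (y *_) xs ++ pairProducts xs) (*-comm x y) ⟩
  y * x ∷ map (x *_) xs ++ map (y *_) xs ++ pairProducts xs
    ↭⟨ prep (y * x) (Perm.shifts (map (x *_) xs) (map (y *_) xs)) ⟩
  y * x ∷ map (y *_) xs ++ map (x *_) xs ++ pairProducts xs
    ↭⟨ prep (y * x) (Perm.++⁺ (Perm.map⁺ (y *_) p)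
                              (Perm.++⁺ (Perm.map⁺ (x *_) p) (pairProducts-↭ p))) ⟩
  y * x ∷ map (y *_) ys ++ map (x *_) ys ++ pairProducts ys ∎
  where open PermutationReasoning
pairProducts-↭ (trans p q)  = ↭-trans (pairProducts-↭ p) (pairProducts-↭ q)

occurrences-filter-< : ∀ {v t} xs → v < t → occurrences v (filter (_<? t) xs) ≡ occurrences v xs
occurrences-filter-< [] v<t = refl
occurrences-filter-< {v} {t} (x ∷ xs) v<t with x <? t
... | yes x<t rewrite List.filter-accept (_<? t) {x} {xs} x<t = cong (δ x v +_) (occurrences-filter-< xs v<t)
... | no  x≮t rewrite List.filter-reject (_<? t) {x} {xs} x≮t
                    | δ-≢ {x} {v} (λ { refl → x≮t v<t }) = occurrences-filter-< xs v<t

occurrences-filter-≥ : ∀ {v t} xs → t ≤ v → occurrences v (filter (_<? t) xs) ≡ 0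
occurrences-filter-≥ [] t≤v = refl
occurrences-filter-≥ {v} {t} (x ∷ xs) t≤v with x <? t
... | yes x<t rewrite List.filter-accept (_<? t) {x} {xs} x<t
                    | δ-≢ {x} {v} (λ { refl → <⇒≱ x<t t≤v }) = occurrences-filter-≥ xs t≤v
... | no  x≮t rewrite List.filter-reject (_<? t) {x} {xs} x≮t = occurrences-filter-≥ xs t≤v

δ-*-small : ∀ {x y t} → 2 ≤ t → x < t → t ≤ y → δ (x * y) t ≡ δ x 1 * δ y t
δ-*-small {zero}        {y} {suc zero}    (s≤s ()) _ _
δ-*-small {zero}        {y} {suc (suc t)} _ _ _ = refl
δ-*-small {suc zero}    {y} {t}           _ _ _ =
  ≡-trans (cong (λ z → δ z t) (+-identityʳ y)) (sym (+-identityʳ (δ y t)))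
δ-*-small {suc (suc x)} {y} {t} 2≤t _ t≤y = δ-≢ (>⇒≢ (≤-<-trans t≤y y<xy))
  where
  y<xy : y < suc (suc x) * y
  y<xy = subst (y <_) (*-comm y (suc (suc x)))
    (m<m*n y (suc (suc x)) {{>-nonZero (≤-trans (s≤s z≤n) (≤-trans 2≤t t≤y))}} (s≤s (s≤s z≤n)))

δ-*-large : ∀ {x y t} → 2 ≤ t → t ≤ x → δ (x * y) t ≡ δ x t * δ y 1
δ-*-large {x} {zero} {suc zero} (s≤s ()) _
δ-*-large {x} {zero} {suc (suc t)} _ _ =
  ≡-trans (cong (λ z → δ z (suc (suc t))) (*-zeroʳ x)) (sym (*-zeroʳ (δ x (suc (suc t)))))
δ-*-large {x} {suc zero} {t} _ _ =
  ≡-trans (cong (λ z → δ z t) (*-identityʳ x)) (sym (*-identityʳ (δ x t)))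
δ-*-large {x} {suc (suc y)} {t} 2≤t t≤x =
  ≡-trans (δ-≢ (>⇒≢ (≤-<-trans t≤x (m<m*n x (suc (suc y)) {{x≢0}} (s≤s (s≤s z≤n))))))
          (sym (*-zeroʳ (δ x t)))
  where
  x≢0 : NonZero x
  x≢0 = >-nonZero (≤-trans (s≤s z≤n) (≤-trans 2≤t t≤x))

occurrences-map-*-small : ∀ {t x} → 2 ≤ t → x < t → ∀ ys →
  occurrences t (map (x *_) ys) ≡ occurrences t (map (x *_) (filter (_<? t) ys)) + δ x 1 * occurrences t ys
occurrences-map-*-small {t} {x} 2≤t x<t [] = sym (*-zeroʳ (δ x 1))
occurrences-map-*-small {t} {x} 2≤t x<t (y ∷ ys) with y <? t
... | yes y<t rewrite List.filter-accept (_<? t) {y} {ys} y<t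
                    | occurrences-map-*-small 2≤t x<t ys
                    | δ-≢ (<⇒≢ y<t) =
  sym (+-assoc (δ (x * y) t) _ _)
... | no  y≮t rewrite List.filter-reject (_<? t) {y} {ys} y≮t
                    | occurrences-map-*-small 2≤t x<t ys
                    | δ-*-small 2≤t x<t (≮⇒≥ y≮t) =
  rearrange (δ x 1) (δ y t) (occurrences t (map (x *_) (filter (_<? t) ys))) (occurrences t ys)
  where
  rearrange : ∀ a b F O → a * b + (F + a * O) ≡ F + a * (b + O)
  rearrange = solve-∀

occurrences-map-*-large : ∀ {t x} → 2 ≤ t → t ≤ x → ∀ ys →
  occurrences t (map (x *_) ys) ≡ δ x t * occurrences 1 ys
occurrences-map-*-large {t} {x} 2≤t t≤x []       = sym (*-zeroʳ (δ x t))
occurrences-map-*-large {t} {x} 2≤t t≤x (y ∷ ys) =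
  ≡-trans (cong₂ _+_ (δ-*-large 2≤t t≤x) (occurrences-map-*-large 2≤t t≤x ys))
          (sym (*-distribˡ-+ (δ x t) (δ y 1) _))

-- For t ≥ 2, a pair of parts with product t and a part ≥ t is a pair {t, 1}.
occurrences-pairProducts : ∀ {t} → 2 ≤ t → ∀ xs →
  occurrences t (pairProducts xs)
    ≡ occurrences t (pairProducts (filter (_<? t) xs)) + occurrences 1 xs * occurrences t xs
occurrences-pairProducts {t} 2≤t [] = refl
occurrences-pairProducts {t} 2≤t (x ∷ xs) with x <? t
... | yes x<t rewrite List.filter-accept (_<? t) {x} {xs} x<t
                    | occurrences-++ t (map (x *_) xs) (pairProducts xs)
                    | occurrences-++ t (map (x *_) (filter (_<? t) xs)) (pairProducts (filter (_<? t) xs))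
                    | occurrences-map-*-small 2≤t x<t xs
                    | occurrences-pairProducts 2≤t xs
                    | δ-≢ (<⇒≢ x<t) =
  rearrange (occurrences t (map (x *_) (filter (_<? t) xs))) (δ x 1) (occurrences t xs)
            (occurrences t (pairProducts (filter (_<? t) xs))) (occurrences 1 xs)
  where
  rearrange : ∀ F a O G c → F + a * O + (G + c * O) ≡ F + G + (a + c) * (0 + O)
  rearrange = solve-∀
... | no  x≮t rewrite List.filter-reject (_<? t) {x} {xs} x≮t
                    | occurrences-++ t (map (x *_) xs) (pairProducts xs)
                    | occurrences-map-*-large 2≤t (≮⇒≥ x≮t) xs
                    | occurrences-pairProducts 2≤t xs
                    | δ-≢ {x} {1} (>⇒≢ (<-≤-trans (s≤s (s≤s z≤n)) (≤-trans 2≤t (≮⇒≥ x≮t)))) =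
  rearrange (δ x t) (occurrences 1 xs) (occurrences t (pairProducts (filter (_<? t) xs))) (occurrences t xs)
  where
  rearrange : ∀ b c G O → b * c + (G + c * O) ≡ G + (0 + c) * (b + O)
  rearrange = solve-∀

pairProducts-injective : ∀ {xs ys} → Linked _≥_ xs → Linked _≥_ ys → All (0 <_) xs → All (0 <_) ys →
  2 ≤ m1 xs → pairProducts xs ↭ pairProducts ys → xs ≡ ys
pairProducts-injective {xs} {ys} xs↘ ys↘ xs>0 ys>0 2≤m1 pp↭ =
  Linked-≥-↭⇒≡ xs↘ ys↘ (↭-occurrences xs ys (<-rec _ same))
  where
  c : ℕ
  c = occurrences 1 xs

  2≤c : 2 ≤ c
  2≤c = subst (2 ≤_) (m1≡occurrences xs) 2≤m1

  ones : c ≡ occurrences 1 ys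
  ones = C2-injective 2≤c (begin
    c C 2                             ≡⟨ occurrences-one-pairProducts xs ⟨
    occurrences 1 (pairProducts xs)   ≡⟨ occurrences-↭ 1 pp↭ ⟩
    occurrences 1 (pairProducts ys)   ≡⟨ occurrences-one-pairProducts ys ⟩
    occurrences 1 ys C 2              ∎)
    where open ≡-Reasoning

  zeros : ∀ {zs} → All (0 <_) zs → occurrences 0 zs ≡ 0
  zeros zs>0 = occurrences-absent 0 (All.map n>0⇒n≢0 zs>0)

  same : ∀ t → (∀ {s} → s < t → occurrences s xs ≡ occurrences s ys) →
         occurrences t xs ≡ occurrences t ys
  same zero          _     = ≡-trans (zeros xs>0) (sym (zeros ys>0))
  same (suc zero)    _     = ones
  same t@(suc (suc _)) below =
    *-cancelˡ-≡ _ _ c {{>-nonZero (<-≤-trans (s≤s z≤n) 2≤c)}}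
      (+-cancelˡ-≡ (occurrences t (pairProducts (filter (_<? t) xs))) _ _ (begin
        occurrences t (pairProducts (filter (_<? t) xs)) + c * occurrences t xs
          ≡⟨ occurrences-pairProducts 2≤t xs ⟨
        occurrences t (pairProducts xs)
          ≡⟨ occurrences-↭ t pp↭ ⟩
        occurrences t (pairProducts ys)
          ≡⟨ occurrences-pairProducts 2≤t ys ⟩
        occurrences t (pairProducts (filter (_<? t) ys)) + occurrences 1 ys * occurrences t ys
          ≡⟨ cong₂ (λ a b → a + b * occurrences t ys)
                   (occurrences-↭ t (pairProducts-↭ (↭-sym small↭))) (sym ones) ⟩
        occurrences t (pairProducts (filter (_<? t) xs)) + c * occurrences t ys ∎))
    where
    open ≡-Reasoning
    2≤t : 2 ≤ t
    2≤t = s≤s (s≤s z≤n)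
    small↭ : filter (_<? t) xs ↭ filter (_<? t) ys
    small↭ = ↭-occurrences _ _ λ v → case v <? t of λ where
      (yes v<t) → ≡-trans (occurrences-filter-< xs v<t)
                    (≡-trans (below v<t) (sym (occurrences-filter-< ys v<t)))
      (no  v≮t) → ≡-trans (occurrences-filter-≥ xs (≮⇒≥ v≮t))
                    (sym (occurrences-filter-≥ ys (≮⇒≥ v≮t)))

pre₂ : List ℕ → List ℕ
pre₂ xs = sort≥ (pairProducts xs)

IsPre2-pre₂ : ∀ xs → IsPre2 xs (pre₂ xs)
IsPre2-pre₂ xs = sort≥-↗ (pairProducts xs) , sort≥-↭ (pairProducts xs)

IsPre2⇒≡pre₂ : ∀ {xs μ} → IsPre2 xs μ → μ ≡ pre₂ xs
IsPre2⇒≡pre₂ {xs} (μ↘ , μ↭) =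
  Linked-≥-↭⇒≡ μ↘ (sort≥-↗ (pairProducts xs)) (↭-trans μ↭ (↭-sym (sort≥-↭ (pairProducts xs))))

m1-pre₂ : ∀ xs → m1 (pre₂ xs) ≡ m1 xs C 2
m1-pre₂ xs = ≡-trans (m1-↭ (sort≥-↭ (pairProducts xs))) (m1-pairProducts xs)

pre₂-injective : ∀ {xs ys} → Linked _≥_ xs → Linked _≥_ ys → All (0 <_) xs → All (0 <_) ys →
  2 ≤ m1 xs → pre₂ xs ≡ pre₂ ys → xs ≡ ys
pre₂-injective {xs} {ys} xs↘ ys↘ xs>0 ys>0 2≤m1 eq = pairProducts-injective xs↘ ys↘ xs>0 ys>0 2≤m1 (begin
  pairProducts xs  ↭⟨ sort≥-↭ (pairProducts xs) ⟨
  pre₂ xs          ≡⟨ eq ⟩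
  pre₂ ys          ↭⟨ sort≥-↭ (pairProducts ys) ⟩
  pairProducts ys  ∎)
  where open PermutationReasoning

-- Part (a)

module ImageOfPre₂ (d : ℕ) (1≤d : 1 ≤ d) (n : ℕ) where

  D : ℕ
  D = 2 * d + 1

  3≤D : 3 ≤ D
  3≤D = 3≤2d+1 1≤d

  open DaryPartitions D (≤-trans (s≤s (s≤s z≤n)) 3≤D)

  candidates : List (List ℕ)
  candidates = daryPartitions D (n ∸ 2) n

  candidate-complete : ∀ {xs} → IsDaryPartition D n xs → xs ∈ candidates
  candidate-complete {xs} xs⊢n@(_ , xs-pow , xs-sum) = complete (n ∸ 2) n xs⊢n
    (All.tabulate (λ x∈ → bound (All.lookup xs-pow x∈) (subst (_ ≤_) xs-sum (∈⇒≤sum x∈))))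
    where
    bound : ∀ {x} → IsPowerOf D x → x ≤ n → x ≤ D ^ (n ∸ 2)
    bound (k , refl) = power≤n⇒≤^[n∸2] {k = k} 3≤D

  candidate-shape : ∀ {xs} → xs ∈ candidates → Linked _≥_ xs × All (0 <_) xs
  candidate-shape xs∈ with sound (n ∸ 2) n xs∈
  ... | (xs↘ , xs-pow , _) , _ = xs↘ , All.map (λ { (k , refl) → m^n>0 D k }) xs-pow

  twoOnes? : Decidable (λ xs → 2 ≤ m1 xs)
  twoOnes? xs = 2 ≤? m1 xs

  twoPartsFewOnes? : Decidable (λ xs → 2 ≤ length xs × ¬ (2 ≤ m1 xs))
  twoPartsFewOnes? xs = (2 ≤? length xs) ×-dec ¬? (2 ≤? m1 xs)

  rich poor : List (List ℕ)
  rich = filter twoOnes? candidates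
  poor = filter twoPartsFewOnes? candidates

  -- pre₂ is injective on rich, and the images of poor have no part 1, so removing their
  -- duplicates does not change the sum of m₁.
  poorImages : List (List ℕ)
  poorImages = deduplicate (List.≡-dec _≟_) (map pre₂ poor)

  images : List (List ℕ)
  images = map pre₂ rich ++ poorImages

  ∈-rich⁻ : ∀ {xs} → xs ∈ rich → xs ∈ candidates × 2 ≤ m1 xs
  ∈-rich⁻ = ∈-filter⁻ twoOnes? {xs = candidates}

  ∈-poorImages⁻ : ∀ {μ} → μ ∈ poorImages →
    ∃[ xs ] μ ≡ pre₂ xs × xs ∈ candidates × 2 ≤ length xs × ¬ (2 ≤ m1 xs)
  ∈-poorImages⁻ μ∈ with ∈-map⁻ pre₂ (∈-deduplicate⁻ (List.≡-dec _≟_) (map pre₂ poor) μ∈)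
  ... | xs , xs∈ , μ≡ with ∈-filter⁻ twoPartsFewOnes? {xs = candidates} xs∈
  ...   | xs∈c , two , few = xs , μ≡ , xs∈c , two , few

  poorImages-m1 : ∀ {μ} → μ ∈ poorImages → m1 μ ≡ 0
  poorImages-m1 μ∈ with ∈-poorImages⁻ μ∈
  ... | xs , refl , _ , _ , few = ≡-trans (m1-pre₂ xs) (C2-vanishing few)

  images-unique : Unique images
  images-unique = Unique.++⁺
    (Unique-map-injectiveOn pre₂ rich-injective (Unique.filter⁺ twoOnes? (unique (n ∸ 2) n)))
    (deduplicate-! (map pre₂ poor))
    disjoint
    where
    rich-injective : ∀ {xs ys} → xs ∈ rich → ys ∈ rich → pre₂ xs ≡ pre₂ ys → xs ≡ ys
    rich-injective xs∈ ys∈ with ∈-rich⁻ xs∈ | ∈-rich⁻ ys∈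
    ... | xs∈c , many | ys∈c , _ with candidate-shape xs∈c | candidate-shape ys∈c
    ...   | xs↘ , xs>0 | ys↘ , ys>0 = pre₂-injective xs↘ ys↘ xs>0 ys>0 many
    disjoint : ∀ {μ} → ¬ (μ ∈ map pre₂ rich × μ ∈ poorImages)
    disjoint (μ∈rich , μ∈poor) with ∈-map⁻ pre₂ μ∈rich
    ... | xs , xs∈ , refl = contradiction (≡-trans (sym (m1-pre₂ xs)) (poorImages-m1 μ∈poor))
                                          (>⇒≢ (C2-positive (proj₂ (∈-rich⁻ xs∈))))

  ∈-images⇔ : ∀ μ → (μ ∈ images) ⇔ InImP2 D n μ
  ∈-images⇔ μ = mk⇔ to from
    where
    to : μ ∈ images → InImP2 D n μ
    to μ∈ with ∈-++⁻ (map pre₂ rich) μ∈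
    ... | inj₁ μ∈rich with ∈-map⁻ pre₂ μ∈rich
    ...   | xs , xs∈ , refl with ∈-rich⁻ xs∈
    ...     | xs∈c , many = xs , (proj₁ (sound (n ∸ 2) n xs∈c) , ≤-trans many (m1≤length xs)) , IsPre2-pre₂ xs
    to μ∈ | inj₂ μ∈poor with ∈-poorImages⁻ μ∈poor
    ...   | xs , refl , xs∈c , two , _ = xs , (proj₁ (sound (n ∸ 2) n xs∈c) , two) , IsPre2-pre₂ xs
    from : InImP2 D n μ → μ ∈ images
    from (xs , (xs⊢n , two) , pre) rewrite IsPre2⇒≡pre₂ {xs} pre with twoOnes? xs
    ... | yes many = ∈-++⁺ˡ (∈-map⁺ pre₂ (∈-filter⁺ twoOnes? (candidate-complete xs⊢n) many))
    ... | no  few  = ∈-++⁺ʳ (map pre₂ rich) (∈-deduplicate⁺ (List.≡-dec _≟_)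
                       (∈-map⁺ pre₂ (∈-filter⁺ twoPartsFewOnes? (candidate-complete xs⊢n) (two , few))))

  sum-m1-images : sum (map m1 images) ≡ rhsCoef d n
  sum-m1-images = begin
    sum (map m1 (map pre₂ rich ++ poorImages))
      ≡⟨ cong sum (List.map-++ m1 (map pre₂ rich) poorImages) ⟩
    sum (map m1 (map pre₂ rich) ++ map m1 poorImages)
      ≡⟨ sum-++ (map m1 (map pre₂ rich)) (map m1 poorImages) ⟩
    sum (map m1 (map pre₂ rich)) + sum (map m1 poorImages)
      ≡⟨ cong₂ _+_ (cong sum (sym (List.map-∘ rich))) (sum-map-vanishing m1 poorImages poorImages-m1) ⟩
    sum (map (m1 ∘ pre₂) rich) + 0
      ≡⟨ +-identityʳ _ ⟩
    sum (map (m1 ∘ pre₂) rich)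
      ≡⟨ cong sum (List.map-cong m1-pre₂ rich) ⟩
    sum (map (λ xs → m1 xs C 2) rich)
      ≡⟨ sum-map-filter twoOnes? (λ xs → m1 xs C 2) candidates (λ _ → C2-vanishing) ⟩
    sum (map (λ xs → m1 xs C 2) candidates)
      ≡⟨ sum-m1C2 (n ∸ 2) n ⟩
    pairsOfOnes D (n ∸ 2) n
      ≡⟨ rhsCoef-pairsOfOnes d n ⟨
    rhsCoef d n ∎
    where open ≡-Reasoning

-- Sublists

module _ {A : Set} where

  sublists : List A → List (List A)
  sublists []       = [ [] ]
  sublists (x ∷ xs) = map (x ∷_) (sublists xs) ++ sublists xs

  ∈-sublists⁻ : ∀ {ys} xs → ys ∈ sublists xs → ys ⊆ xs
  ∈-sublists⁻ []       (here refl) = []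
  ∈-sublists⁻ (x ∷ xs) ys∈ with ∈-++⁻ (map (x ∷_) (sublists xs)) ys∈
  ... | inj₁ ys∈₁ with ∈-map⁻ (x ∷_) ys∈₁
  ...   | zs , zs∈ , refl = refl ∷ ∈-sublists⁻ xs zs∈
  ∈-sublists⁻ (x ∷ xs) ys∈ | inj₂ ys∈₂ = x ∷ʳ ∈-sublists⁻ xs ys∈₂

  ∈-sublists⁺ : ∀ {ys xs} → ys ⊆ xs → ys ∈ sublists xs
  ∈-sublists⁺ []                       = here refl
  ∈-sublists⁺ {xs = x ∷ xs} (x ∷ʳ p)   = ∈-++⁺ʳ (map (x ∷_) (sublists xs)) (∈-sublists⁺ p)
  ∈-sublists⁺ (refl ∷ p)               = ∈-++⁺ˡ (∈-map⁺ (_ ∷_) (∈-sublists⁺ p))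

  sublists-unique : ∀ {xs} → Unique xs → Unique (sublists xs)
  sublists-unique {[]}     _            = [] ∷ []
  sublists-unique {x ∷ xs} (x∉xs ∷ xs!) =
    Unique.++⁺ (Unique.map⁺ List.∷-injectiveʳ (sublists-unique xs!)) (sublists-unique xs!) disjoint
    where
    disjoint : ∀ {ys} → ¬ (ys ∈ map (x ∷_) (sublists xs) × ys ∈ sublists xs)
    disjoint (ys∈₁ , ys∈₂) with ∈-map⁻ (x ∷_) ys∈₁
    ... | zs , _ , refl = All.lookup x∉xs (Any-resp-⊆ (∈-sublists⁻ xs ys∈₂) (here refl)) refl

  module _ (w : A → ℕ) where

    hasWeight? : ∀ n → Decidable (λ ys → sum (map w ys) ≡ n)
    hasWeight? n ys = sum (map w ys) ≟ n

    ofWeight : ℕ → List (List A) → List (List A)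
    ofWeight n = filter (hasWeight? n)

    length-ofWeight-map-∷ : ∀ x S n →
      length (ofWeight n (map (x ∷_) S)) ≡ shift (w x) (λ m → length (ofWeight m S)) n
    length-ofWeight-map-∷ x []       n = sym (shift-zero (w x) n)
    length-ofWeight-map-∷ x (ys ∷ S) n = begin
      length (ofWeight n (map (x ∷_) (ys ∷ S)))
        ≡⟨ length-filter-∷ (hasWeight? n) (x ∷ ys) (map (x ∷_) S) ⟩
      δ (w x + sum (map w ys)) n + length (ofWeight n (map (x ∷_) S))
        ≡⟨ cong₂ _+_ (sym (shift-δ (w x) (sum (map w ys)) n)) (length-ofWeight-map-∷ x S n) ⟩
      shift (w x) (δ (sum (map w ys))) n + shift (w x) (λ m → length (ofWeight m S)) n
        ≡⟨ shift-+ (w x) (δ (sum (map w ys))) (λ m → length (ofWeight m S)) n ⟨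
      shift (w x) (λ m → δ (sum (map w ys)) m + length (ofWeight m S)) n
        ≡⟨ shift-cong (w x) n (λ m _ → length-filter-∷ (hasWeight? m) ys S) ⟨
      shift (w x) (λ m → length (ofWeight m (ys ∷ S))) n ∎
      where open ≡-Reasoning

    length-ofWeight-sublists : ∀ xs n → length (ofWeight n (sublists xs)) ≡ prodS (map w xs) n
    length-ofWeight-sublists []       zero    = refl
    length-ofWeight-sublists []       (suc n) = refl
    length-ofWeight-sublists (x ∷ xs) n = begin
      length (ofWeight n (map (x ∷_) (sublists xs) ++ sublists xs))
        ≡⟨ cong length (List.filter-++ (hasWeight? n) (map (x ∷_) (sublists xs)) (sublists xs)) ⟩
      length (ofWeight n (map (x ∷_) (sublists xs)) ++ ofWeight n (sublists xs))
        ≡⟨ List.length-++ (ofWeight n (map (x ∷_) (sublists xs))) ⟩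
      length (ofWeight n (map (x ∷_) (sublists xs))) + length (ofWeight n (sublists xs))
        ≡⟨ cong₂ _+_ (≡-trans (length-ofWeight-map-∷ x (sublists xs) n)
                               (shift-cong (w x) n (λ m _ → length-ofWeight-sublists xs m)))
                     (length-ofWeight-sublists xs n) ⟩
      shift (w x) (prodS (map w xs)) n + prodS (map w xs) n
        ≡⟨ +-comm (shift (w x) (prodS (map w xs)) n) _ ⟩
      prodS (map w xs) n + shift (w x) (prodS (map w xs)) n
        ≡⟨ prodS-∷ (w x) (map w xs) n ⟨
      prodS (map w (x ∷ xs)) n ∎
      where open ≡-Reasoning

-- Color partitions

rank : ColoredPart → ℕ
rank (s , c) = 3 * s + toℕ c

rank-<-size : ∀ {s s′} (c c′ : Fin 3) → s < s′ → rank (s , c) < rank (s′ , c′)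
rank-<-size {s} {s′} c c′ s<s′ = begin-strict
  3 * s + toℕ c    <⟨ +-monoʳ-< (3 * s) (Fin.toℕ<n c) ⟩
  3 * s + 3        ≡⟨ +-comm (3 * s) 3 ⟩
  3 + 3 * s        ≡⟨ *-suc 3 s ⟨
  3 * suc s        ≤⟨ *-monoʳ-≤ 3 s<s′ ⟩
  3 * s′           ≤⟨ m≤m+n (3 * s′) (toℕ c′) ⟩
  3 * s′ + toℕ c′  ∎
  where open ≤-Reasoning

rank-<⇒≺ : ∀ x y → rank x < rank y → x ≺ y
rank-<⇒≺ (s , c) (s′ , c′) lt with <-cmp s s′
... | tri< s<s′ _ _ = inj₁ s<s′
... | tri≈ _ refl _ = inj₂ (refl , +-cancelˡ-< (3 * s) (toℕ c) (toℕ c′) lt)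
... | tri> _ _ s>s′ = contradiction lt (<-asym (rank-<-size c′ c s>s′))

rank-injective : ∀ x y → rank x ≡ rank y → x ≡ y
rank-injective (s , c) (s′ , c′) eq with <-cmp s s′
... | tri< s<s′ _ _ = contradiction eq (<⇒≢ (rank-<-size c c′ s<s′))
... | tri≈ _ refl _ = cong (s ,_) (Fin.toℕ-injective (+-cancelˡ-≡ (3 * s) _ _ eq))
... | tri> _ _ s>s′ = contradiction (sym eq) (<⇒≢ (rank-<-size c′ c s>s′))

≺-irrefl : ∀ {x} → ¬ x ≺ x
≺-irrefl (inj₁ s<s)       = <-irrefl refl s<s
≺-irrefl (inj₂ (_ , c<c)) = <-irrefl refl c<c

≺-trans : ∀ {x y z} → x ≺ y → y ≺ z → x ≺ z
≺-trans (inj₁ a)          (inj₁ b)          = inj₁ (<-trans a b)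
≺-trans (inj₁ a)          (inj₂ (refl , _)) = inj₁ a
≺-trans (inj₂ (refl , _)) (inj₁ b)          = inj₁ b
≺-trans (inj₂ (refl , a)) (inj₂ (refl , b)) = inj₂ (refl , <-trans a b)

_≻_ : ColoredPart → ColoredPart → Set
x ≻ y = y ≺ x

≻-trans : ∀ {x y z} → x ≻ y → y ≻ z → x ≻ z
≻-trans y≺x z≺y = ≺-trans z≺y y≺x

_≟ᶜ_ : DecidableEquality ColoredPart
_≟ᶜ_ = ×-≡-dec _≟_ Fin._≟_

open Sort (On.decTotalOrder ≥-decTotalOrder rank) using ()
  renaming (sort to sortByRank; sort-↭ to sortByRank-↭; sort-↗ to sortByRank-↗)

rank-sorted⇒≻ : ∀ {xs} → Linked (λ x y → rank y ≤ rank x) xs → Unique xs → Linked _≻_ xs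
rank-sorted⇒≻ []                 _                 = []
rank-sorted⇒≻ [-]                _                 = [-]
rank-sorted⇒≻ {x ∷ y ∷ _} (y≤x ∷ xs↘) ((x≢y ∷ _) ∷ xs!) =
  rank-<⇒≺ y x (≤∧≢⇒< y≤x (λ eq → x≢y (rank-injective x y (sym eq)))) ∷ rank-sorted⇒≻ xs↘ xs!

module ColoredPartitions (d : ℕ) (1≤d : 1 ≤ d) (n : ℕ) where

  D : ℕ
  D = 2 * d + 1

  1<D : 1 < D
  1<D = ≤-trans (s≤s (s≤s z≤n)) (3≤2d+1 1≤d)

  instance
    D≢0 : NonZero D
    D≢0 = >-nonZero (<-trans (s≤s z≤n) 1<D)

  I : List ℕ
  I = upTo (suc n)

  extraColors : List (Fin 3)
  extraColors = Fin.suc Fin.zero ∷ Fin.suc (Fin.suc Fin.zero) ∷ []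

  extraPart : ℕ → Fin 3 → ColoredPart
  extraPart i c = (2 ^ i , c)

  basePart : ℕ → ℕ → ColoredPart
  basePart i j = (2 ^ i * D ^ j , Fin.zero)

  extraColored baseColored allowedParts : List ColoredPart
  extraColored = cartesianProductWith extraPart I extraColors
  baseColored  = cartesianProductWith basePart I I
  allowedParts  = extraColored ++ baseColored

  map-partSize-allowedParts : map partSize allowedParts ≡ allExponents d n
  map-partSize-allowedParts =
    ≡-trans (List.map-++ partSize extraColored baseColored)
            (cong₂ _++_ (map-cartesianProductWith partSize extraPart I extraColors)
                        (map-cartesianProductWith partSize basePart I I))

  extra-color : ∀ {v} → v ∈ extraColored → proj₂ v ≢ Fin.zero
  extra-color v∈ with ∈-cartesianProductWith⁻ extraPart I extraColors v∈
  ... | _ , _ , _ , here refl , refl = λ ()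
  ... | _ , _ , _ , there (here refl) , refl = λ ()

  base-color : ∀ {v} → v ∈ baseColored → proj₂ v ≡ Fin.zero
  base-color v∈ with ∈-cartesianProductWith⁻ basePart I I v∈
  ... | _ , _ , _ , _ , refl = refl

  allowedParts-unique : Unique allowedParts
  allowedParts-unique = Unique.++⁺
    (Unique.cartesianProductWith⁺ extraPart extra-injective (Unique.upTo⁺ (suc n))
                                  (((λ ()) ∷ []) ∷ [] ∷ []))
    (Unique.cartesianProductWith⁺ basePart base-injective (Unique.upTo⁺ (suc n)) (Unique.upTo⁺ (suc n)))
    (λ (v∈extra , v∈base) → extra-color v∈extra (base-color v∈base))
    where
    extra-injective : ∀ {i i′ c c′} → extraPart i c ≡ extraPart i′ c′ → i ≡ i′ × c ≡ c′
    extra-injective eq = ^-injectiveʳ 2 (s≤s (s≤s z≤n)) (cong proj₁ eq) , cong proj₂ eq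
    base-injective : ∀ {i i′ j j′} → basePart i j ≡ basePart i′ j′ → i ≡ i′ × j ≡ j′
    base-injective {i} {i′} {j} {j′} eq
      with 2^*odd-injective i i′ (2∤[2d+1]^ d j) (2∤[2d+1]^ d j′) (cong proj₁ eq)
    ... | i≡i′ , D^j≡D^j′ = i≡i′ , ^-injectiveʳ D 1<D D^j≡D^j′

  allowedParts-sound : ∀ {v} → v ∈ allowedParts → AllowedPart d v
  allowedParts-sound v∈ with ∈-++⁻ extraColored v∈
  ... | inj₁ v∈extra with ∈-cartesianProductWith⁻ extraPart I extraColors v∈extra
  ...   | i , _ , _ , _ , refl = (i , 0 , sym (*-identityʳ (2 ^ i))) , λ _ → i , refl
  allowedParts-sound v∈ | inj₂ v∈base with ∈-cartesianProductWith⁻ basePart I I v∈base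
  ...   | i , j , _ , _ , refl = (i , j , refl) , λ c≢0 → contradiction refl c≢0

  allowedParts-complete : ∀ {v} → AllowedPart d v → partSize v ≤ n → v ∈ allowedParts
  allowedParts-complete {s , Fin.zero} ((i , j , refl) , _) s≤n =
    ∈-++⁺ʳ extraColored (∈-cartesianProductWith⁺ basePart (index i 2^i≤s) (index j 2^j≤s))
    where
    index : ∀ k → 2 ^ k ≤ 2 ^ i * D ^ j → k ∈ I
    index k 2^k≤s = ∈-upTo⁺ (s≤s (≤-trans (<⇒≤ (n<2^n k)) (≤-trans 2^k≤s s≤n)))
    2^i≤s : 2 ^ i ≤ 2 ^ i * D ^ j
    2^i≤s = m≤m*n (2 ^ i) (D ^ j) {{m^n≢0 D j}}
    2^j≤s : 2 ^ j ≤ 2 ^ i * D ^ j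
    2^j≤s = ≤-trans (^-monoˡ-≤ j 1<D) (m≤n*m (D ^ j) (2 ^ i) {{m^n≢0 2 i}})
  allowedParts-complete {s , Fin.suc Fin.zero} (_ , extra) s≤n with extra (λ ())
  ... | i , refl = ∈-++⁺ˡ (∈-cartesianProductWith⁺ extraPart {xs = I} {ys = extraColors}
                     (∈-upTo⁺ (s≤s (≤-trans (<⇒≤ (n<2^n i)) s≤n))) (here refl))
  allowedParts-complete {s , Fin.suc (Fin.suc Fin.zero)} (_ , extra) s≤n with extra (λ ())
  ... | i , refl = ∈-++⁺ˡ (∈-cartesianProductWith⁺ extraPart {xs = I} {ys = extraColors}
                     (∈-upTo⁺ (s≤s (≤-trans (<⇒≤ (n<2^n i)) s≤n))) (there (here refl)))

  parts : List ColoredPart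
  parts = sortByRank allowedParts

  parts-unique : Unique parts
  parts-unique = PermSetoid.Unique-resp-↭ (setoid ColoredPart)
    (↭⇒↭ₛ (↭-sym (sortByRank-↭ allowedParts))) allowedParts-unique

  parts-decreasing : AllPairs _≻_ parts
  parts-decreasing = Linked.Linked⇒AllPairs ≻-trans (rank-sorted⇒≻ (sortByRank-↗ allowedParts) parts-unique)

  colorPartitions : List (List ColoredPart)
  colorPartitions = ofWeight partSize n (sublists parts)

  colorPartitions-unique : Unique colorPartitions
  colorPartitions-unique = Unique.filter⁺ (hasWeight? partSize n) (sublists-unique parts-unique)

  ∈-colorPartitions⇔ : ∀ π → (π ∈ colorPartitions) ⇔ IsQ d n π
  ∈-colorPartitions⇔ π = mk⇔ to from
    where
    to : π ∈ colorPartitions → IsQ d n π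
    to π∈ with ∈-filter⁻ (hasWeight? partSize n) {xs = sublists parts} π∈
    ... | π∈sub , π-sum =
      Linked.AllPairs⇒Linked (AllPairs-resp-⊆ π⊆ parts-decreasing)
      , All.tabulate (λ v∈ → allowedParts-sound
                              (Perm.∈-resp-↭ (sortByRank-↭ allowedParts) (Any-resp-⊆ π⊆ v∈)))
      , π-sum
      where
      π⊆ : π ⊆ parts
      π⊆ = ∈-sublists⁻ parts π∈sub
    from : IsQ d n π → π ∈ colorPartitions
    from (π↘ , π-allowed , π-sum) = ∈-filter⁺ (hasWeight? partSize n) (∈-sublists⁺ π⊆) π-sum
      where
      in-parts : ∀ {v} → v ∈ π → v ∈ parts
      in-parts {v} v∈ = Perm.∈-resp-↭ (↭-sym (sortByRank-↭ allowedParts))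
        (allowedParts-complete (All.lookup π-allowed v∈)
                               (subst (partSize v ≤_) π-sum (∈⇒≤sum (∈-map⁺ partSize v∈))))
      π⊆ : π ⊆ parts
      π⊆ = ⊆-strictlySorted ≺-irrefl ≻-trans _≟ᶜ_
             (Linked.Linked⇒AllPairs ≻-trans π↘) parts-decreasing in-parts

  length-colorPartitions : length colorPartitions ≡ infProdCoef d n
  length-colorPartitions = begin
    length colorPartitions             ≡⟨ length-ofWeight-sublists partSize parts n ⟩
    prodS (map partSize parts) n        ≡⟨ prodS-↭ (Perm.map⁺ partSize (sortByRank-↭ allowedParts)) n ⟩
    prodS (map partSize allowedParts) n ≡⟨ cong (λ es → prodS es n) map-partSize-allowedParts ⟩
    prodS (allExponents d n) n          ≡⟨ prodS-filter n (allExponents d n) ≤-refl ⟨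
    infProdCoef d n                     ∎
    where open ≡-Reasoning

theorem4p5 : (d : ℕ) → 1 ≤ d →
    ((n : ℕ) → M1ImP2Is (2 * d + 1) n (rhsCoef d n))
    × ((n : ℕ) → Σ ℕ (λ k → QCountIs d n k × M1ImP2Is (2 * d + 1) (n + 2) k))
theorem4p5 d 1≤d = partA , partB
  where
  partA : (n : ℕ) → M1ImP2Is (2 * d + 1) n (rhsCoef d n)
  partA n = images , images-unique , ∈-images⇔ , sum-m1-images
    where open ImageOfPre₂ d 1≤d n

  partB : (n : ℕ) → Σ ℕ (λ k → QCountIs d n k × M1ImP2Is (2 * d + 1) (n + 2) k)
  partB n = infProdCoef d n
          , (colorPartitions , colorPartitions-unique , ∈-colorPartitions⇔ , length-colorPartitions)
          , subst (M1ImP2Is (2 * d + 1) (n + 2)) (cong (rhsCoef d) (+-comm n 2)) (partA (n + 2))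
    where open ColoredPartitions d 1≤d n
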